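{- Let $n\ge 4$ and let $\Gamma$ be a connected simple graph of order $n$ with exactly one bridge. Then \[ SO(\Gamma)\ge 2(n-3)\sqrt{2}+\sqrt{10}+2\sqrt{13}, \] with equality if and only if $\Gamma\cong \mathbb{P}_n^1$.
   Context: The Sombor index of a graph $\Gamma$ is $SO(\Gamma)=\sum_{uv\in E(\Gamma)}\sqrt{\deg_\Gamma(u)^2+\deg_\Gamma(v)^2}$. A bridge is an edge whose deletion disconnects the graph. $\mathbb{P}_n^1$ is the graph obtained from the cycle $C_{n-1}$ by adding one new vertex adjacent to exactly one vertex of the cycle. -}

module Defs where

open import Data.Nat using (ℕ; zero; suc; _+_; _*_; _∸_; _^_; _≤_; _≤ᵇ_; _<ᵇ_; _≡ᵇ_)
open import Data.Bool using (Bool; true; false; if_then_else_; _∧_; _∨_; not)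
open import Data.Fin using (Fin; toℕ)
open import Data.Nat.ListAction using (sum)
open import Data.List using (List; []; _∷_; _++_; map; length; concatMap; allFin; replicate)
open import Data.Product using (_×_; _,_; Σ; ∃)
open import Data.Sum using (_⊎_)
open import Relation.Nullary using (¬_)
open import Relation.Binary.PropositionalEquality using (_≡_)
open import Function.Bundles using (_⤖_; Bijection)

-- Exact comparison of finite sums of square roots of naturals.
-- A list xs = [a₁ , … , a_m] stands for the real number √a₁ + … + √a_m.

sqrtSearch : ℕ → ℕ → ℕ
sqrtSearch m zero = zero
sqrtSearch m (suc r) = if (suc r * suc r) ≤ᵇ m then suc r else sqrtSearch m r

floorSqrt : ℕ → ℕ
floorSqrt m = sqrtSearch m m

-- Σ ⌊2^k √aᵢ⌋ = Σ ⌊√(4^k aᵢ)⌋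
approx : ℕ → List ℕ → ℕ
approx k xs = sum (map (λ a → floorSqrt (4 ^ k * a)) xs)

-- Σ √xᵢ ≤ Σ √yⱼ  (as real numbers).  Exact characterisation:
--   approx k xs ≤ 2^k·Σ√xᵢ  and  2^k·Σ√yⱼ ≤ approx k ys + length ys.
_≤√_ : List ℕ → List ℕ → Set
xs ≤√ ys = ∀ k → approx k xs ≤ approx k ys + length ys

_≡√_ : List ℕ → List ℕ → Set
xs ≡√ ys = (xs ≤√ ys) × (ys ≤√ xs)

Graph : ℕ → Set
Graph n = Fin n → Fin n → Bool

IsSimple : ∀ {n} → Graph n → Set
IsSimple G = (∀ u v → G u v ≡ G v u) × (∀ u → G u u ≡ false)

data Reach {n} (G : Graph n) : Fin n → Fin n → Set where
  here : ∀ {u} → Reach G u u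
  step : ∀ {u v w} → G u v ≡ true → Reach G v w → Reach G u w

Connected : ∀ {n} → Graph n → Set
Connected G = ∀ u v → Reach G u v

_=ᶠ_ : ∀ {n} → Fin n → Fin n → Bool
x =ᶠ y = toℕ x ≡ᵇ toℕ y

deleteEdge : ∀ {n} → Graph n → Fin n → Fin n → Graph n
deleteEdge G u v x y = G x y ∧ not (((x =ᶠ u) ∧ (y =ᶠ v)) ∨ ((x =ᶠ v) ∧ (y =ᶠ u)))

-- uv is a bridge of G (G connected is a separate hypothesis)
IsBridge : ∀ {n} → Graph n → Fin n → Fin n → Set
IsBridge G u v = (G u v ≡ true) × ¬ Connected (deleteEdge G u v)

ExactlyOneBridge : ∀ {n} → Graph n → Set
ExactlyOneBridge {n} G =
  Σ (Fin n) λ u → Σ (Fin n) λ v → IsBridge G u v ×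
    (∀ x y → IsBridge G x y → ((x ≡ u) × (y ≡ v)) ⊎ ((x ≡ v) × (y ≡ u)))

degree : ∀ {n} → Graph n → Fin n → ℕ
degree {n} G u = sum (map (λ v → if G u v then 1 else 0) (allFin n))

somborTerms : ∀ {n} → Graph n → List ℕ
somborTerms {n} G =
  concatMap (λ u → concatMap (λ v →
      if (toℕ u <ᵇ toℕ v) ∧ G u v
      then (degree G u ^ 2 + degree G v ^ 2) ∷ []
      else []) (allFin n)) (allFin n)
-- SO(G) = Σ √t over t ∈ somborTerms G

-- the right-hand side 2(n-3)√2 + √10 + 2√13 = (n-3)·√8 + √10 + √13 + √13
somborBound : ℕ → List ℕ
somborBound n = replicate (n ∸ 3) 8 ++ (10 ∷ 13 ∷ 13 ∷ [])

_≅_ : ∀ {n} → Graph n → Graph n → Set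
_≅_ {n} G H = Σ (Fin n ⤖ Fin n) λ f →
  ∀ u v → G u v ≡ H (Bijection.to f u) (Bijection.to f v)

-- ℙₙ¹ : cycle on vertices 0,…,n-2 plus vertex n-1 adjacent to vertex 0.
cycAdj : ℕ → ℕ → ℕ → Bool
cycAdj n i j = (i <ᵇ (n ∸ 1)) ∧ (j <ᵇ (n ∸ 1)) ∧
  ((j ≡ᵇ suc i) ∨ ((i ≡ᵇ 0) ∧ (j ≡ᵇ (n ∸ 2))))

pendAdj : ℕ → ℕ → ℕ → Bool
pendAdj n i j = (i ≡ᵇ (n ∸ 1)) ∧ (j ≡ᵇ 0)

P1 : (n : ℕ) → Graph n
P1 n u v = cycAdj n (toℕ u) (toℕ v) ∨ cycAdj n (toℕ v) (toℕ u)
         ∨ pendAdj n (toℕ u) (toℕ v) ∨ pendAdj n (toℕ v) (toℕ u)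

{-# OPTIONS --safe #-}
module Submission where

-- The Sombor sum is counted over ordered edges (each edge twice) and compared with the bound
-- through the exact approximations ⌊2ᵏ√t⌋, which are monotone in t.  A graph with exactly one
-- bridge either has a pendant vertex w whose neighbour p has degree ≥ 3 while all other degrees
-- are ≥ 2, or has minimum degree 2 and a vertex p of degree ≥ 3: a pendant edge is a bridge, and
-- at an end of the bridge of degree 2 the other edge would be a second bridge.  Lowering every
-- degree to its value in ℙₙ¹ (1 at w, 3 at p, 2 elsewhere) only decreases the edge weights, and
-- with those degrees the ordered edge uv weighs ⌊2ᵏ√8⌋ + κ([u = p] + [v = p]) − γ([u = w] + [v = w]),
-- where κ = ⌊2ᵏ√13⌋ − ⌊2ᵏ√8⌋ and γ = ⌊2ᵏ√13⌋ − ⌊2ᵏ√10⌋.  Summing, twice the Sombor sum is at least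
-- ⌊2ᵏ√8⌋·Σdeg + 2κ·deg p − 2γ·deg w, and Σdeg ≥ 2n gives the bound.  In the equality case
-- Σdeg = 2n, so G has the degrees of ℙₙ¹; walking from p away from w then runs around a cycle
-- through all the other vertices, which identifies G with ℙₙ¹.

open import Defs
open import Data.Nat.Properties using (+-*-semiring)
open import Algebra.Properties.Semiring.Sum +-*-semiring
  using (sum; sum-syntax; ∑-distrib-+; ∑-comm; *-distribˡ-sum; sum-cong-≗; sum-permute)
open import Data.Bool using (Bool; true; false; if_then_else_; _∧_; _∨_; not; T)
open import Data.Bool.Properties using (∧-identityʳ; ∧-zeroʳ; ∨-comm; ∧-comm; T-≡; T-∧; T-∨)
import Data.Bool.Properties as Bool
open import Data.Empty using (⊥-elim)
open import Data.Fin using (Fin; zero; suc; toℕ; fromℕ<)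
open import Data.Fin.Properties using (_≟_; toℕ-injective; toℕ<n; toℕ-fromℕ<; any?; injective⇒≤)
open import Data.List using (List; []; _∷_; _++_; map; concatMap; allFin; tabulate; replicate; length)
open import Data.List.Properties using (map-tabulate; map-++)
import Data.Nat.ListAction as List
open import Data.Nat.ListAction.Properties using (sum-++)
open import Data.Nat using (ℕ; zero; suc; pred; _+_; _*_; _^_; _∸_; _≤_; _<_; z≤n; s≤s; s≤s⁻¹; _≤?_; _≡ᵇ_; _<ᵇ_; _≤ᵇ_)
open import Data.Nat.Properties hiding (_≟_)
open import Data.Nat.Properties using () renaming (_≟_ to _≟ℕ_)
open import Data.Nat.Tactic.RingSolver using (solve-∀)
open import Data.Product using (∃; _×_; _,_; proj₁; proj₂)
open import Data.Product.Function.NonDependent.Propositional using (_×-⇔_)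
open import Data.Sum using (_⊎_; inj₁; inj₂; [_,_])
open import Data.Sum.Function.Propositional using (_⊎-⇔_)
open import Function using (_∘_; id)
open import Function.Bundles using (_⇔_; _⤖_; mk⇔; mk⤖; Equivalence; Inverse)
open import Function.Construct.Composition using (_⇔-∘_)
open import Function.Construct.Symmetry using (⇔-sym)
open import Function.Properties.Bijection using (⤖⇒↔)
open import Relation.Binary using (tri<; tri≈; tri>)
open import Relation.Binary.PropositionalEquality hiding ([_])
open import Relation.Nullary using (¬_; Dec; yes; no; does)
open import Relation.Nullary.Decidable using (_×-dec_; ¬?)

-- Sums over Fin n and counting

ι : Bool → ℕ
ι b = if b then 1 else 0

sum-mono-≤ : ∀ {n} {f g : Fin n → ℕ} → (∀ i → f i ≤ g i) → sum f ≤ sum g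
sum-mono-≤ {zero}  f≤g = z≤n
sum-mono-≤ {suc n} f≤g = +-mono-≤ (f≤g zero) (sum-mono-≤ (f≤g ∘ suc))

sum-const : ∀ n c → ∑[ i < n ] c ≡ n * c
sum-const zero    c = refl
sum-const (suc n) c = cong (c +_) (sum-const n c)

term≤sum : ∀ {n} (f : Fin n → ℕ) i → f i ≤ sum f
term≤sum f zero    = m≤m+n (f zero) _
term≤sum f (suc i) = ≤-trans (term≤sum (f ∘ suc) i) (m≤n+m _ (f zero))

sum-pos : ∀ {n} (f : Fin n → ℕ) → 1 ≤ sum f → ∃ λ i → 1 ≤ f i
sum-pos {zero}  f ()
sum-pos {suc n} f pos with f zero in eq
... | suc _ = zero , subst (1 ≤_) (sym eq) (s≤s z≤n)
... | zero with sum-pos (f ∘ suc) pos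
...   | i , fi≥1 = suc i , fi≥1

sum-squeeze : ∀ {n} {f g : Fin n → ℕ} → (∀ i → f i ≤ g i) → sum g ≤ sum f → ∀ i → f i ≡ g i
sum-squeeze {suc n} {f} {g} f≤g g≤f i = go i
  where
  rest≤ : sum (f ∘ suc) ≤ sum (g ∘ suc)
  rest≤ = sum-mono-≤ (f≤g ∘ suc)
  head≥ : g zero ≤ f zero
  head≥ = +-cancelʳ-≤ _ _ _ (≤-trans g≤f (+-monoʳ-≤ (f zero) rest≤))
  rest≥ : sum (g ∘ suc) ≤ sum (f ∘ suc)
  rest≥ = +-cancelˡ-≤ (g zero) _ _ (≤-trans g≤f (+-monoˡ-≤ _ (f≤g zero)))
  go : ∀ i → f i ≡ g i
  go zero    = ≤-antisym (f≤g zero) head≥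
  go (suc i) = sum-squeeze (f≤g ∘ suc) rest≥ i

δ : ∀ {n} → Fin n → Fin n → ℕ
δ c i = ι (does (i ≟ c))

δ-diag : ∀ {n} (c : Fin n) → δ c c ≡ 1
δ-diag c with c ≟ c
... | yes _  = refl
... | no c≢c = ⊥-elim (c≢c refl)

δ-offdiag : ∀ {n} {c i : Fin n} → ¬ i ≡ c → δ c i ≡ 0
δ-offdiag {c = c} {i} i≢c with i ≟ c
... | yes i≡c = ⊥-elim (i≢c i≡c)
... | no _    = refl

sum-δ-* : ∀ {n} (c : Fin n) (f : Fin n → ℕ) → ∑[ i < n ] (δ c i * f i) ≡ f c
sum-δ-* {suc n} zero f =
  trans (cong₂ _+_ (*-identityˡ (f zero)) (trans (sum-const n 0) (*-zeroʳ n))) (+-identityʳ (f zero))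
sum-δ-* {suc n} (suc c) f = sum-δ-* c (f ∘ suc)

sum-δ : ∀ {n} (c : Fin n) → sum (δ c) ≡ 1
sum-δ c = trans (sum-cong-≗ (λ i → sym (*-identityʳ (δ c i)))) (sum-δ-* c (λ _ → 1))

count : ∀ {n} → (Fin n → Bool) → ℕ
count {n} b = ∑[ i < n ] ι (b i)

_∖_ : ∀ {n} → (Fin n → Bool) → Fin n → Fin n → Bool
(b ∖ x) i = b i ∧ not (does (i ≟ x))

∖-intro : ∀ {n} {b : Fin n → Bool} {x y} → b y ≡ true → ¬ y ≡ x → (b ∖ x) y ≡ true
∖-intro {x = x} {y} by y≢x with y ≟ x
... | yes y≡x = ⊥-elim (y≢x y≡x)
... | no _    = trans (∧-identityʳ _) by

∖-elim : ∀ {n} {b : Fin n → Bool} {x y} → (b ∖ x) y ≡ true → b y ≡ true × ¬ y ≡ x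
∖-elim {b = b} {x} {y} e with y ≟ x | b y
... | no y≢x | true = refl , y≢x

count-∖ : ∀ {n} {b : Fin n → Bool} {x} → b x ≡ true → count b ≡ suc (count (b ∖ x))
count-∖ {n} {b} {x} bx = begin
  count b                                       ≡⟨ sum-cong-≗ split ⟩
  ∑[ i < n ] (δ x i + ι ((b ∖ x) i))            ≡⟨ ∑-distrib-+ (δ x) _ ⟩
  sum (δ x) + count (b ∖ x)                     ≡⟨ cong (_+ count (b ∖ x)) (sum-δ x) ⟩
  suc (count (b ∖ x))                           ∎
  where
  open ≡-Reasoning
  split : ∀ i → ι (b i) ≡ δ x i + ι ((b ∖ x) i)
  split i with i ≟ x
  ... | yes refl rewrite bx = refl
  ... | no _     = cong ι (sym (∧-identityʳ (b i)))

count≡0⇒false : ∀ {n} {b : Fin n → Bool} → count b ≡ 0 → ∀ i → b i ≡ false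
count≡0⇒false {b = b} c≡0 i with b i in bi
... | false = refl
... | true  with () ← ≤-trans (subst (λ t → ι t ≤ count b) bi (term≤sum (λ j → ι (b j)) i)) (≤-reflexive c≡0)

false⇒count≡0 : ∀ {n} {b : Fin n → Bool} → (∀ i → b i ≡ false) → count b ≡ 0
false⇒count≡0 {n} {b} none = trans (sum-cong-≗ (λ i → cong ι (none i))) (trans (sum-const n 0) (*-zeroʳ n))

count≥1⇒∃ : ∀ {n} {b : Fin n → Bool} → 1 ≤ count b → ∃ λ v → b v ≡ true
count≥1⇒∃ {b = b} pos with sum-pos (λ i → ι (b i)) pos
... | i , bi≥1 with b i in bi
...   | true = i , bi

module _ {n} {b : Fin n → Bool} where

  count-∖-≥ : ∀ {k a} → suc k ≤ count b → b a ≡ true → k ≤ count (b ∖ a)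
  count-∖-≥ k<c ba = s≤s⁻¹ (subst (_ ≤_) (count-∖ {b = b} ba) k<c)

  count-∖-≤ : ∀ {k a} → count b ≤ suc k → b a ≡ true → count (b ∖ a) ≤ k
  count-∖-≤ c≤k ba = s≤s⁻¹ (subst (_≤ _) (count-∖ {b = b} ba) c≤k)

  count-∖-empty : ∀ {a} → (∀ y → b y ≡ true → y ≡ a) → count (b ∖ a) ≡ 0
  count-∖-empty {a} only = false⇒count≡0 none
    where
    none : ∀ y → (b ∖ a) y ≡ false
    none y with (b ∖ a) y in e
    ... | false = refl
    ... | true  with by , y≢a ← ∖-elim {b = b} e = ⊥-elim (y≢a (only y by))

  count≥2⇒∃≢ : ∀ {a} → 2 ≤ count b → b a ≡ true → ∃ λ v → b v ≡ true × ¬ v ≡ a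
  count≥2⇒∃≢ {a} c≥2 ba with v , e ← count≥1⇒∃ {b = b ∖ a} (count-∖-≥ c≥2 ba) = v , ∖-elim {b = b} e

  count≤1⇒≡ : ∀ {a y} → count b ≤ 1 → b a ≡ true → b y ≡ true → y ≡ a
  count≤1⇒≡ {a} {y} c≤1 ba by with y ≟ a
  ... | yes y≡a = y≡a
  ... | no y≢a  with () ← trans (sym (count≡0⇒false (n≤0⇒n≡0 (count-∖-≤ c≤1 ba)) y)) (∖-intro {b = b} by y≢a)

  count≡1 : ∀ {a} → b a ≡ true → (∀ y → b y ≡ true → y ≡ a) → count b ≡ 1
  count≡1 ba only = trans (count-∖ {b = b} ba) (cong suc (count-∖-empty only))

count≥3⇒∃≢≢ : ∀ {n} {b : Fin n → Bool} {a c} → 3 ≤ count b → b a ≡ true → b c ≡ true → ¬ c ≡ a →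
  ∃ λ v → b v ≡ true × ¬ v ≡ a × ¬ v ≡ c
count≥3⇒∃≢≢ {b = b} {a} c≥3 ba bc c≢a with v , e , v≢c ← count≥2⇒∃≢ {b = b ∖ a} (count-∖-≥ {b = b} c≥3 ba) (∖-intro {b = b} bc c≢a) =
  v , proj₁ (∖-elim {b = b} e) , proj₂ (∖-elim {b = b} e) , v≢c

count≤2⇒⊎ : ∀ {n} {b : Fin n → Bool} {a c y} → count b ≤ 2 → b a ≡ true → b c ≡ true → ¬ c ≡ a →
  b y ≡ true → y ≡ a ⊎ y ≡ c
count≤2⇒⊎ {b = b} {a} {y = y} c≤2 ba bc c≢a by with y ≟ a
... | yes y≡a = inj₁ y≡a
... | no y≢a  = inj₂ (count≤1⇒≡ {b = b ∖ a} (count-∖-≤ {b = b} c≤2 ba) (∖-intro {b = b} bc c≢a) (∖-intro {b = b} by y≢a))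

count≤3⇒⊎ : ∀ {n} {b : Fin n → Bool} {a c d y} → count b ≤ 3 → b a ≡ true → b c ≡ true → b d ≡ true →
  ¬ c ≡ a → ¬ d ≡ a → ¬ d ≡ c → b y ≡ true → y ≡ a ⊎ y ≡ c ⊎ y ≡ d
count≤3⇒⊎ {b = b} {a} {y = y} c≤3 ba bc bd c≢a d≢a d≢c by with y ≟ a
... | yes y≡a = inj₁ y≡a
... | no y≢a  = inj₂ (count≤2⇒⊎ {b = b ∖ a} (count-∖-≤ {b = b} c≤3 ba) (∖-intro {b = b} bc c≢a) (∖-intro {b = b} bd d≢a) d≢c (∖-intro {b = b} by y≢a))

count≡2 : ∀ {n} {b : Fin n → Bool} {a c} → b a ≡ true → b c ≡ true → ¬ c ≡ a →
  (∀ y → b y ≡ true → y ≡ a ⊎ y ≡ c) → count b ≡ 2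
count≡2 {b = b} {a} {c} ba bc c≢a only = trans (count-∖ {b = b} ba) (cong suc (count≡1 {b = b ∖ a} (∖-intro {b = b} bc c≢a) only′))
  where
  only′ : ∀ y → (b ∖ a) y ≡ true → y ≡ c
  only′ y e with by , y≢a ← ∖-elim {b = b} e with only y by
  ... | inj₁ y≡a = ⊥-elim (y≢a y≡a)
  ... | inj₂ y≡c = y≡c

count≡3 : ∀ {n} {b : Fin n → Bool} {a c d} → b a ≡ true → b c ≡ true → b d ≡ true →
  ¬ c ≡ a → ¬ d ≡ a → ¬ d ≡ c → (∀ y → b y ≡ true → y ≡ a ⊎ y ≡ c ⊎ y ≡ d) → count b ≡ 3
count≡3 {b = b} {a} ba bc bd c≢a d≢a d≢c only =
  trans (count-∖ {b = b} ba) (cong suc (count≡2 {b = b ∖ a} (∖-intro {b = b} bc c≢a) (∖-intro {b = b} bd d≢a) d≢c only′))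
  where
  only′ : ∀ y → (b ∖ a) y ≡ true → _
  only′ y e with by , y≢a ← ∖-elim {b = b} e with only y by
  ... | inj₁ y≡a = ⊥-elim (y≢a y≡a)
  ... | inj₂ rest = rest

-- Reachability and bridges

Undirected : ∀ {n} → Graph n → Set
Undirected G = ∀ a b → G a b ≡ G b a

Loopless : ∀ {n} → Graph n → Set
Loopless G = ∀ u → G u u ≡ false

deg : ∀ {n} → Graph n → Fin n → ℕ
deg G u = count (G u)

listSum-tabulate : ∀ {n} (f : Fin n → ℕ) → List.sum (tabulate f) ≡ sum f
listSum-tabulate {zero}  f = refl
listSum-tabulate {suc n} f = cong (f zero +_) (listSum-tabulate (f ∘ suc))

listSum-allFin : ∀ {n} (f : Fin n → ℕ) → List.sum (map f (allFin n)) ≡ sum f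
listSum-allFin {n} f = trans (cong List.sum (map-tabulate {n = n} id f)) (listSum-tabulate f)

degree≡deg : ∀ {n} (G : Graph n) u → degree G u ≡ deg G u
degree≡deg G u = listSum-allFin (λ v → ι (G u v))

edge-sym : ∀ {n} {G : Graph n} → Undirected G → ∀ {a b} → G a b ≡ true → G b a ≡ true
edge-sym undirected {a} {b} e = trans (undirected b a) e

edge⇒≢ : ∀ {n} {G : Graph n} → Loopless G → ∀ {u v} → G u v ≡ true → ¬ u ≡ v
edge⇒≢ {G = G} loopless {u} e refl with () ← trans (sym e) (loopless u)

=ᶠ≡does : ∀ {n} (x y : Fin n) → (x =ᶠ y) ≡ does (x ≟ y)
=ᶠ≡does x y with x ≟ y
... | yes refl = Equivalence.to T-≡ (≡⇒≡ᵇ (toℕ x) (toℕ x) refl)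
... | no x≢y with x =ᶠ y in e
...   | false = refl
...   | true  = ⊥-elim (x≢y (toℕ-injective (≡ᵇ⇒≡ _ _ (Equivalence.from T-≡ e))))

=ᶠ-refl : ∀ {n} (x : Fin n) → (x =ᶠ x) ≡ true
=ᶠ-refl x with x ≟ x | =ᶠ≡does x x
... | yes _  | e = e
... | no x≢x | _ = ⊥-elim (x≢x refl)

=ᶠ∧=ᶠ-false : ∀ {n} {a b u v : Fin n} → ¬ (a ≡ u × b ≡ v) → ((a =ᶠ u) ∧ (b =ᶠ v)) ≡ false
=ᶠ∧=ᶠ-false {a = a} {b} {u} {v} ne rewrite =ᶠ≡does a u | =ᶠ≡does b v with a ≟ u | b ≟ v
... | yes refl | yes refl = ⊥-elim (ne (refl , refl))
... | yes _    | no _     = refl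
... | no _     | _        = refl

module _ {n} (G : Graph n) where

  deleteEdge-⊆ : ∀ {u v a b} → deleteEdge G u v a b ≡ true → G a b ≡ true
  deleteEdge-⊆ {a = a} {b} e with G a b
  ... | true = refl

  deleteEdge-keeps : ∀ {u v a b} → G a b ≡ true → ¬ (a ≡ u × b ≡ v) → ¬ (a ≡ v × b ≡ u) →
    deleteEdge G u v a b ≡ true
  deleteEdge-keeps {a = a} {b} e ¬uv ¬vu rewrite =ᶠ∧=ᶠ-false ¬uv | =ᶠ∧=ᶠ-false ¬vu = trans (∧-identityʳ (G a b)) e

  deleteEdge-removes : ∀ u v → deleteEdge G u v u v ≡ false
  deleteEdge-removes u v rewrite =ᶠ-refl u | =ᶠ-refl v = ∧-zeroʳ (G u v)

  deleteEdge-comm : ∀ u v a b → deleteEdge G u v a b ≡ deleteEdge G v u a b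
  deleteEdge-comm u v a b = cong (λ z → G a b ∧ not z) (∨-comm ((a =ᶠ u) ∧ (b =ᶠ v)) _)

  deleteEdge-undirected : Undirected G → ∀ u v → Undirected (deleteEdge G u v)
  deleteEdge-undirected undirected u v a b = cong₂ (λ g z → g ∧ not z) (undirected a b)
    (trans (∨-comm ((a =ᶠ u) ∧ (b =ᶠ v)) _) (cong₂ _∨_ (∧-comm (a =ᶠ v) _) (∧-comm (a =ᶠ u) _)))

Reach-trans : ∀ {n} {G : Graph n} {x y z} → Reach G x y → Reach G y z → Reach G x z
Reach-trans here       r′ = r′
Reach-trans (step e r) r′ = step e (Reach-trans r r′)

Reach-bind : ∀ {n} {G H : Graph n} → (∀ {a b} → G a b ≡ true → Reach H a b) → ∀ {x y} → Reach G x y → Reach H x y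
Reach-bind edge here       = here
Reach-bind edge (step e r) = Reach-trans (edge e) (Reach-bind edge r)

Reach-map : ∀ {n} {G H : Graph n} → (∀ {a b} → G a b ≡ true → H a b ≡ true) → ∀ {x y} → Reach G x y → Reach H x y
Reach-map sub = Reach-bind (λ e → step (sub e) here)

Reach-sym : ∀ {n} {G : Graph n} → Undirected G → ∀ {x y} → Reach G x y → Reach G y x
Reach-sym undirected here       = here
Reach-sym undirected (step e r) = Reach-trans (Reach-sym undirected r) (step (edge-sym undirected e) here)

Reach-closed : ∀ {n} {G : Graph n} (S : Fin n → Set) → (∀ {a b} → S a → G a b ≡ true → S b) →
  ∀ {x y} → S x → Reach G x y → S y
Reach-closed S closed sx here       = sx
Reach-closed S closed sx (step e r) = Reach-closed S closed (closed sx e) r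

module _ {n} {G : Graph n} where

  isolatedEdge-disconnected : ∀ {w p z} → (∀ y → G w y ≡ true → y ≡ p) → (∀ y → G p y ≡ true → y ≡ w) →
    ¬ z ≡ w → ¬ z ≡ p → ¬ Connected G
  isolatedEdge-disconnected {w} {p} {z} only-w only-p z≢w z≢p connected =
    [ z≢w , z≢p ] (Reach-closed (λ a → a ≡ w ⊎ a ≡ p) closed (inj₁ refl) (connected w z))
    where
    closed : ∀ {a b} → a ≡ w ⊎ a ≡ p → G a b ≡ true → b ≡ w ⊎ b ≡ p
    closed (inj₁ refl) e = inj₂ (only-w _ e)
    closed (inj₂ refl) e = inj₁ (only-p _ e)

  pendant-isBridge : Loopless G → ∀ {w p} → G w p ≡ true → (∀ y → G w y ≡ true → y ≡ p) → IsBridge G w p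
  pendant-isBridge loopless {w} {p} wp only = wp , λ connected →
    edge⇒≢ loopless wp (sym (Reach-closed (_≡ w) stuck refl (connected w p)))
    where
    stuck : ∀ {a b} → a ≡ w → deleteEdge G w p a b ≡ true → b ≡ w
    stuck {b = b} refl e with only b (deleteEdge-⊆ G e)
    ... | refl with () ← trans (sym e) (deleteEdge-removes G w p)

module _ {n} {G : Graph n} (undirected : Undirected G) where

  deleteEdge-connected : Connected G → ∀ {u v} → Reach (deleteEdge G u v) u v → Connected (deleteEdge G u v)
  deleteEdge-connected connected {u} {v} detour a b = Reach-bind edge (connected a b)
    where
    edge : ∀ {x y} → G x y ≡ true → Reach (deleteEdge G u v) x y
    edge {x} {y} e with (x ≟ u ×-dec y ≟ v) | (x ≟ v ×-dec y ≟ u)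
    ... | yes (refl , refl) | _                  = detour
    ... | no _              | yes (refl , refl) = Reach-sym (deleteEdge-undirected G undirected u v) detour
    ... | no ¬uv            | no ¬vu            = step (deleteEdge-keeps G e ¬uv ¬vu) here

  IsBridge-sym : ∀ {u v} → IsBridge G u v → IsBridge G v u
  IsBridge-sym {u} {v} (e , disconnected) = edge-sym undirected e ,
    λ connected → disconnected (λ a b → Reach-map (λ {x} {y} → trans (deleteEdge-comm G u v x y)) (connected a b))

  bridge-through-degree-2 : Loopless G → Connected G → ∀ {u v x} → (∀ y → G u y ≡ true → y ≡ v ⊎ y ≡ x) → ¬ v ≡ x →
    G u x ≡ true → IsBridge G u v → IsBridge G u x
  bridge-through-degree-2 loopless connected {u} {v} {x} nbrs v≢x ux (uv , disconnected) =
    ux , λ connected-ux → disconnected (deleteEdge-connected connected (u↝v (connected-ux v x)))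
    where
    G-ux = deleteEdge G u x
    G-uv = deleteEdge G u v
    x≢u : ¬ x ≡ u
    x≢u x≡u = edge⇒≢ loopless ux (sym x≡u)
    -- Followed backwards from x, a path of G-ux avoids u until it reaches v, since v is u's only neighbour there.
    towards-x : ∀ {a} → Reach G-ux a x → Reach G-uv v x ⊎ (¬ a ≡ u × Reach G-uv a x)
    towards-x here = inj₂ (x≢u , here)
    towards-x (step {a} {b} e r) with a ≟ u | towards-x r
    ... | no a≢u | inj₁ v↝x        = inj₁ v↝x
    ... | no a≢u | inj₂ (b≢u , b↝x) =
      inj₂ (a≢u , step (deleteEdge-keeps G (deleteEdge-⊆ G e) (a≢u ∘ proj₁) (b≢u ∘ proj₂)) b↝x)
    ... | yes refl | ih with nbrs b (deleteEdge-⊆ G e)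
    ...   | inj₂ refl with () ← trans (sym e) (deleteEdge-removes G u x)
    ...   | inj₁ refl = inj₁ ([ id , proj₂ ] ih)
    u↝v : Reach G-ux v x → Reach G-uv u v
    u↝v r = step u-x (Reach-sym (deleteEdge-undirected G undirected u v) ([ id , proj₂ ] (towards-x r)))
      where u-x = deleteEdge-keeps G ux (λ p → v≢x (sym (proj₂ p))) (λ p → edge⇒≢ loopless uv (proj₁ p))

count-all : ∀ {n} → count {n} (λ _ → true) ≡ n
count-all {n} = trans (sum-const n 1) (*-identityʳ n)

bridge-endpoint : ∀ {n} {G : Graph n} → ExactlyOneBridge G →
  ∀ {x y u v} → IsBridge G x y → IsBridge G u v → u ≡ x ⊎ u ≡ y
bridge-endpoint (_ , _ , _ , unique) xy uv with unique _ _ xy | unique _ _ uv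
... | inj₁ (refl , refl) | inj₁ (refl , _) = inj₁ refl
... | inj₁ (refl , refl) | inj₂ (refl , _) = inj₂ refl
... | inj₂ (refl , refl) | inj₁ (refl , _) = inj₂ refl
... | inj₂ (refl , refl) | inj₂ (refl , _) = inj₁ refl

module OneBridge {n} (G : Graph n) (undirected : Undirected G) (loopless : Loopless G)
                 (connected : Connected G) (one-bridge : ExactlyOneBridge G) (3≤n : 3 ≤ n) where

  deg-pos : ∀ u → 1 ≤ deg G u
  deg-pos u with z , _ , z≢u ← count≥2⇒∃≢ {b = λ (_ : Fin n) → true} (subst (2 ≤_) (sym (count-all {n})) (≤-trans (n≤1+n 2) 3≤n)) refl
             with connected u z
  ... | here     = ⊥-elim (z≢u refl)
  ... | step e _ = subst (1 ≤_) (sym (count-∖ {b = G u} e)) (s≤s z≤n)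

  data Shape : Set where
    pendant   : ∀ w p → G w p ≡ true → deg G w ≡ 1 → 3 ≤ deg G p → (∀ u → ¬ u ≡ w → 2 ≤ deg G u) → Shape
    noPendant : ∀ c → 3 ≤ deg G c → (∀ u → 2 ≤ deg G u) → Shape

  private
    third-vertex : ∀ a b → ¬ b ≡ a → ∃ λ z → ¬ z ≡ a × ¬ z ≡ b
    third-vertex a b b≢a with z , _ , z≢a , z≢b ← count≥3⇒∃≢≢ {b = λ (_ : Fin n) → true} (subst (3 ≤_) (sym (count-all {n})) 3≤n) refl refl b≢a =
      z , z≢a , z≢b

  bridges-at-vertex : ∀ {u v x} → IsBridge G u v → IsBridge G u x → v ≡ x
  bridges-at-vertex uv ux with bridge-endpoint one-bridge uv (IsBridge-sym undirected ux)
  ... | inj₁ x≡u = ⊥-elim (edge⇒≢ loopless (proj₁ ux) (sym x≡u))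
  ... | inj₂ x≡v = sym x≡v

  bridge-endpoint-deg≢2 : ∀ {a b} → IsBridge G a b → ¬ deg G a ≡ 2
  bridge-endpoint-deg≢2 {a} {b} ab d≡2
    with x , ax , x≢b ← count≥2⇒∃≢ {b = G a} (≤-reflexive (sym d≡2)) (proj₁ ab) =
    x≢b (sym (bridges-at-vertex ab (bridge-through-degree-2 undirected loopless connected nbrs (x≢b ∘ sym) ax ab)))
    where
    nbrs : ∀ y → G a y ≡ true → y ≡ b ⊎ y ≡ x
    nbrs y = count≤2⇒⊎ {b = G a} (≤-reflexive d≡2) (proj₁ ab) ax x≢b

  pendant-neighbour-deg≥3 : ∀ {w p} → G w p ≡ true → (∀ y → G w y ≡ true → y ≡ p) → 3 ≤ deg G p
  pendant-neighbour-deg≥3 {w} {p} wp only-w with deg G p ≤? 1 | deg G p ≟ℕ 2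
  ... | yes d≤1 | _ with z , z≢p , z≢w ← third-vertex p w (edge⇒≢ loopless wp) =
    ⊥-elim (isolatedEdge-disconnected only-w (λ y → count≤1⇒≡ {b = G p} d≤1 (edge-sym undirected wp)) z≢w z≢p connected)
  ... | no _    | yes d≡2 =
    ⊥-elim (bridge-endpoint-deg≢2 (IsBridge-sym undirected (pendant-isBridge loopless wp only-w)) d≡2)
  ... | no d≰1  | no d≢2  = ≤∧≢⇒< (≰⇒> d≰1) (d≢2 ∘ sym)

  pendant-others-deg≥2 : ∀ {w p} → G w p ≡ true → deg G w ≡ 1 → 3 ≤ deg G p → ∀ u → ¬ u ≡ w → 2 ≤ deg G u
  pendant-others-deg≥2 {w} {p} wp dw dp u u≢w with deg G u ≤? 1
  ... | no d≰1 = ≰⇒> d≰1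
  ... | yes d≤1 with q , uq ← count≥1⇒∃ {b = G u} (deg-pos u)
                with bridge-endpoint one-bridge (leaf-bridge wp (≤-reflexive dw)) (leaf-bridge uq d≤1)
    where
    leaf-bridge : ∀ {x y} → G x y ≡ true → deg G x ≤ 1 → IsBridge G x y
    leaf-bridge xy d≤1 = pendant-isBridge loopless xy (λ z → count≤1⇒≡ {b = G _} d≤1 xy)
  ...   | inj₁ u≡w = ⊥-elim (u≢w u≡w)
  ...   | inj₂ refl = ⊥-elim (<⇒≱ dp (≤-trans d≤1 (n≤1+n 1)))

  shape : Shape
  shape with any? (λ u → deg G u ≤? 1)
  ... | yes (w , d≤1) with p , wp ← count≥1⇒∃ {b = G w} (deg-pos w) =
    pendant w p wp dw dp (pendant-others-deg≥2 wp dw dp)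
    where
    dw = ≤-antisym d≤1 (deg-pos w)
    dp = pendant-neighbour-deg≥3 wp (λ y → count≤1⇒≡ {b = G w} d≤1 wp)
  ... | no no-leaf with any? (λ u → 3 ≤? deg G u)
  ...   | yes (c , dc≥3) = noPendant c dc≥3 deg≥2
    where
    deg≥2 : ∀ u → 2 ≤ deg G u
    deg≥2 u = ≰⇒> (λ d≤1 → no-leaf (u , d≤1))
  ...   | no none≥3 =
    ⊥-elim (bridge-endpoint-deg≢2 ab (≤-antisym (s≤s⁻¹ (≰⇒> (λ d≥3 → none≥3 (a , d≥3)))) (≰⇒> (λ d≤1 → no-leaf (a , d≤1)))))
    where
    a = proj₁ one-bridge
    ab = proj₁ (proj₂ (proj₂ one-bridge))

-- Sums over ordered edges

edgeSum : ∀ {n} → Graph n → (Fin n → Fin n → ℕ) → ℕ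
edgeSum {n} G F = ∑[ u < n ] ∑[ v < n ] (if G u v then F u v else 0)

degSum : ∀ {n} → Graph n → ℕ
degSum {n} G = ∑[ u < n ] deg G u

module _ {n} (G : Graph n) where

  edgeSum-mono : ∀ {F F′} → (∀ {u v} → G u v ≡ true → F u v ≤ F′ u v) → edgeSum G F ≤ edgeSum G F′
  edgeSum-mono F≤F′ = sum-mono-≤ λ u → sum-mono-≤ λ v → pointwise u v
    where
    pointwise : ∀ u v → (if G u v then _ else 0) ≤ (if G u v then _ else 0)
    pointwise u v with G u v in e
    ... | true  = F≤F′ e
    ... | false = z≤n

  edgeSum-cong : ∀ {F F′} → (∀ {u v} → G u v ≡ true → F u v ≡ F′ u v) → edgeSum G F ≡ edgeSum G F′
  edgeSum-cong F≡F′ = ≤-antisym (edgeSum-mono (≤-reflexive ∘ F≡F′)) (edgeSum-mono (≤-reflexive ∘ sym ∘ F≡F′))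

  edgeSum-+ : ∀ F F′ → edgeSum G (λ u v → F u v + F′ u v) ≡ edgeSum G F + edgeSum G F′
  edgeSum-+ F F′ = trans (sum-cong-≗ λ u → trans (sum-cong-≗ λ v → if-+ (G u v)) (∑-distrib-+ (F̂ u) (F̂′ u)))
    (∑-distrib-+ (λ u → sum (F̂ u)) (λ u → sum (F̂′ u)))
    where
    F̂ F̂′ : Fin n → Fin n → ℕ
    F̂ u v = if G u v then F u v else 0
    F̂′ u v = if G u v then F′ u v else 0
    if-+ : ∀ {x y} b → (if b then x + y else 0) ≡ (if b then x else 0) + (if b then y else 0)
    if-+ true  = refl
    if-+ false = refl

  edgeSum-*ˡ : ∀ c F → edgeSum G (λ u v → c * F u v) ≡ c * edgeSum G F
  edgeSum-*ˡ c F = sym (trans (*-distribˡ-sum c (λ u → ∑[ v < n ] (if G u v then F u v else 0)))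
    (sum-cong-≗ λ u → trans (*-distribˡ-sum c (λ v → if G u v then F u v else 0)) (sum-cong-≗ λ v → if-* (G u v))))
    where
    if-* : ∀ {x} b → c * (if b then x else 0) ≡ (if b then c * x else 0)
    if-* true  = refl
    if-* false = *-zeroʳ c

  edgeSum-source : ∀ (A : Fin n → ℕ) → edgeSum G (λ u v → A u) ≡ ∑[ u < n ] (A u * deg G u)
  edgeSum-source A = sum-cong-≗ λ u → trans (sum-cong-≗ λ v → if-ι (G u v)) (sym (*-distribˡ-sum (A u) (λ v → ι (G u v))))
    where
    if-ι : ∀ {x} b → (if b then x else 0) ≡ x * ι b
    if-ι {x} true  = sym (*-identityʳ x)
    if-ι {x} false = sym (*-zeroʳ x)

  edgeSum-target : Undirected G → ∀ (A : Fin n → ℕ) → edgeSum G (λ u v → A v) ≡ ∑[ u < n ] (A u * deg G u)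
  edgeSum-target undirected A = begin
    edgeSum G (λ u v → A v)                                  ≡⟨ ∑-comm (λ u v → if G u v then A v else 0) ⟩
    ∑[ v < n ] ∑[ u < n ] (if G u v then A v else 0)         ≡⟨ sum-cong-≗ (λ v → sum-cong-≗ λ u → cong (if_then A v else 0) (undirected u v)) ⟩
    edgeSum G (λ v u → A v)                                  ≡⟨ edgeSum-source A ⟩
    ∑[ u < n ] (A u * deg G u)                               ∎
    where open ≡-Reasoning

  edgeSum-1 : edgeSum G (λ _ _ → 1) ≡ degSum G
  edgeSum-1 = trans (edgeSum-source (λ _ → 1)) (sum-cong-≗ λ u → *-identityˡ (deg G u))

  edgeSum-δ : Undirected G → ∀ c → edgeSum G (λ u v → δ c u + δ c v) ≡ deg G c + deg G c
  edgeSum-δ undirected c = trans (edgeSum-+ (λ u v → δ c u) (λ u v → δ c v))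
    (cong₂ _+_ (trans (edgeSum-source (δ c)) (sum-δ-* c (deg G))) (trans (edgeSum-target undirected (δ c)) (sum-δ-* c (deg G))))

  edgeSum-affine : Undirected G → ∀ x y c → edgeSum G (λ u v → x + y * (δ c u + δ c v)) ≡ x * degSum G + y * (deg G c + deg G c)
  edgeSum-affine undirected x y c = begin
    edgeSum G (λ u v → x + y * (δ c u + δ c v))                    ≡⟨ edgeSum-+ (λ _ _ → x) (λ u v → y * (δ c u + δ c v)) ⟩
    edgeSum G (λ _ _ → x) + edgeSum G (λ u v → y * (δ c u + δ c v)) ≡⟨ cong (_+ _) (edgeSum-cong (λ _ → sym (*-identityʳ x))) ⟩
    edgeSum G (λ _ _ → x * 1) + edgeSum G (λ u v → y * (δ c u + δ c v)) ≡⟨ cong₂ _+_ (edgeSum-*ˡ x (λ _ _ → 1)) (edgeSum-*ˡ y (λ u v → δ c u + δ c v)) ⟩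
    x * edgeSum G (λ _ _ → 1) + y * edgeSum G (λ u v → δ c u + δ c v) ≡⟨ cong₂ (λ s t → x * s + y * t) edgeSum-1 (edgeSum-δ undirected c) ⟩
    x * degSum G + y * (deg G c + deg G c)                           ∎
    where open ≡-Reasoning

upperSum : ∀ {n} → Graph n → (Fin n → Fin n → ℕ) → ℕ
upperSum {n} G F = ∑[ u < n ] ∑[ v < n ] (if (toℕ u <ᵇ toℕ v) ∧ G u v then F u v else 0)

<ᵇ-false : ∀ {i j} → ¬ i < j → (i <ᵇ j) ≡ false
<ᵇ-false {i} {j} i≮j with i <ᵇ j in e
... | true  = ⊥-elim (i≮j (<ᵇ⇒< i j (Equivalence.from T-≡ e)))
... | false = refl

<ᵇ-true : ∀ {i j} → i < j → (i <ᵇ j) ≡ true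
<ᵇ-true i<j = Equivalence.to T-≡ (<⇒<ᵇ i<j)

upper+lower : ∀ i j g x → (g ≡ true → ¬ i ≡ j) →
  (if (i <ᵇ j) ∧ g then x else 0) + (if (j <ᵇ i) ∧ g then x else 0) ≡ (if g then x else 0)
upper+lower i j false x _ rewrite ∧-zeroʳ (i <ᵇ j) | ∧-zeroʳ (j <ᵇ i) = refl
upper+lower i j true  x i≢j with <-cmp i j
... | tri< i<j _ j≮i rewrite <ᵇ-true i<j | <ᵇ-false j≮i = +-identityʳ x
... | tri≈ _ i≡j _   = ⊥-elim (i≢j refl i≡j)
... | tri> i≮j _ j<i rewrite <ᵇ-true j<i | <ᵇ-false i≮j = refl

upperSum-doubles : ∀ {n} {G : Graph n} → Undirected G → Loopless G → ∀ F → (∀ u v → F u v ≡ F v u) →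
  2 * upperSum G F ≡ edgeSum G F
upperSum-doubles {n} {G} undirected loopless F F-sym = begin
  2 * upperSum G F                                              ≡⟨ cong (X +_) (+-identityʳ X) ⟩
  X + X                                                         ≡⟨ cong (X +_) (∑-comm upper) ⟩
  X + ∑[ v < n ] ∑[ u < n ] upper u v                           ≡⟨ cong (X +_) (sum-cong-≗ λ v → sum-cong-≗ λ u → flip u v) ⟩
  X + ∑[ u < n ] ∑[ v < n ] lower u v                           ≡⟨ ∑-distrib-+ (λ u → sum (upper u)) (λ u → sum (lower u)) ⟨
  ∑[ u < n ] (sum (upper u) + sum (lower u))                    ≡⟨ sum-cong-≗ (λ u → ∑-distrib-+ (upper u) (lower u)) ⟨
  ∑[ u < n ] ∑[ v < n ] (upper u v + lower u v)                 ≡⟨ sum-cong-≗ (λ u → sum-cong-≗ λ v → upper+lower _ _ (G u v) (F u v) (distinct u v)) ⟩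
  edgeSum G F                                                   ∎
  where
  open ≡-Reasoning
  upper lower : Fin n → Fin n → ℕ
  upper u v = if (toℕ u <ᵇ toℕ v) ∧ G u v then F u v else 0
  lower u v = if (toℕ v <ᵇ toℕ u) ∧ G u v then F u v else 0
  X = upperSum G F
  flip : ∀ u v → upper u v ≡ lower v u
  flip u v = cong₂ (λ g x → if (toℕ u <ᵇ toℕ v) ∧ g then x else 0) (undirected u v) (F-sym u v)
  distinct : ∀ u v → G u v ≡ true → ¬ toℕ u ≡ toℕ v
  distinct u v e = edge⇒≢ loopless e ∘ toℕ-injective

sqrtSearch-sq≤ : ∀ m r → sqrtSearch m r * sqrtSearch m r ≤ m
sqrtSearch-sq≤ m zero    = z≤n
sqrtSearch-sq≤ m (suc r) with (suc r * suc r) ≤ᵇ m in e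
... | true  = ≤ᵇ⇒≤ (suc r * suc r) m (Equivalence.from T-≡ e)
... | false = sqrtSearch-sq≤ m r

sqrtSearch-maximal : ∀ m r s → s ≤ r → s * s ≤ m → s ≤ sqrtSearch m r
sqrtSearch-maximal m zero    s s≤r _  = s≤r
sqrtSearch-maximal m (suc r) s s≤r s²≤m with (suc r * suc r) ≤ᵇ m in e
... | true  = s≤r
... | false with m≤n⇒m<n∨m≡n s≤r
...   | inj₁ s<r  = sqrtSearch-maximal m r s (s≤s⁻¹ s<r) s²≤m
...   | inj₂ refl with () ← trans (sym e) (Equivalence.to T-≡ (≤⇒≤ᵇ s²≤m))

floorSqrt-maximal : ∀ {m s} → s * s ≤ m → s ≤ floorSqrt m
floorSqrt-maximal {m} {zero}  _    = z≤n
floorSqrt-maximal {m} {suc s} s²≤m = sqrtSearch-maximal m m (suc s) (≤-trans (m≤m*n (suc s) (suc s)) s²≤m) s²≤m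

floorSqrt-mono : ∀ {m m′} → m ≤ m′ → floorSqrt m ≤ floorSqrt m′
floorSqrt-mono {m} m≤m′ = floorSqrt-maximal (≤-trans (sqrtSearch-sq≤ m m) m≤m′)

scaledSqrt : ℕ → ℕ → ℕ
scaledSqrt k t = floorSqrt (4 ^ k * t)

scaledSqrt-mono : ∀ k {t t′} → t ≤ t′ → scaledSqrt k t ≤ scaledSqrt k t′
scaledSqrt-mono k t≤t′ = floorSqrt-mono (*-monoʳ-≤ (4 ^ k) t≤t′)

scaledSqrt-8 : ∀ k → 2 * 2 ^ k ≤ scaledSqrt k 8
scaledSqrt-8 k = floorSqrt-maximal (≤-trans (≤-reflexive (trans (square k) (*-comm 4 (4 ^ k)))) (*-monoʳ-≤ (4 ^ k) (m≤m+n 4 4)))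
  where
  square : ∀ k → 2 * 2 ^ k * (2 * 2 ^ k) ≡ 4 * 4 ^ k
  square zero    = refl
  square (suc k) = trans (lemma (2 ^ k)) (cong (4 *_) (square k))
    where
    lemma : ∀ x → 2 * (2 * x) * (2 * (2 * x)) ≡ 4 * (2 * x * (2 * x))
    lemma = solve-∀

listSum-concatMap : ∀ {A : Set} (φ : ℕ → ℕ) (f : A → List ℕ) xs →
  List.sum (map φ (concatMap f xs)) ≡ List.sum (map (λ x → List.sum (map φ (f x))) xs)
listSum-concatMap φ f []       = refl
listSum-concatMap φ f (x ∷ xs) = begin
  List.sum (map φ (f x ++ concatMap f xs))                      ≡⟨ cong List.sum (map-++ φ (f x) (concatMap f xs)) ⟩
  List.sum (map φ (f x) ++ map φ (concatMap f xs))              ≡⟨ sum-++ (map φ (f x)) _ ⟩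
  List.sum (map φ (f x)) + List.sum (map φ (concatMap f xs))    ≡⟨ cong (List.sum (map φ (f x)) +_) (listSum-concatMap φ f xs) ⟩
  List.sum (map φ (f x)) + List.sum (map (λ x → List.sum (map φ (f x))) xs) ∎
  where open ≡-Reasoning

approx-somborTerms : ∀ {n} (G : Graph n) k →
  approx k (somborTerms G) ≡ upperSum G (λ u v → scaledSqrt k (degree G u ^ 2 + degree G v ^ 2))
approx-somborTerms {n} G k =
  trans (listSum-concatMap φ row (allFin n)) (trans (listSum-allFin (λ u → List.sum (map φ (row u))))
    (sum-cong-≗ λ u → trans (listSum-concatMap φ (entry u) (allFin n)) (trans (listSum-allFin (λ v → List.sum (map φ (entry u v))))
      (sum-cong-≗ λ v → single ((toℕ u <ᵇ toℕ v) ∧ G u v)))))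
  where
  φ = scaledSqrt k
  entry : Fin n → Fin n → List ℕ
  entry u v = if (toℕ u <ᵇ toℕ v) ∧ G u v then (degree G u ^ 2 + degree G v ^ 2) ∷ [] else []
  row : Fin n → List ℕ
  row u = concatMap (entry u) (allFin n)
  single : ∀ {t} b → List.sum (map φ (if b then t ∷ [] else [])) ≡ (if b then φ t else 0)
  single true  = +-identityʳ _
  single false = refl

twice-approx-somborTerms : ∀ {n} {G : Graph n} → Undirected G → Loopless G → ∀ k →
  2 * approx k (somborTerms G) ≡ edgeSum G (λ u v → scaledSqrt k (deg G u ^ 2 + deg G v ^ 2))
twice-approx-somborTerms {G = G} undirected loopless k = begin
  2 * approx k (somborTerms G)                                     ≡⟨ cong (2 *_) (approx-somborTerms G k) ⟩
  2 * upperSum G (λ u v → scaledSqrt k (degree G u ^ 2 + degree G v ^ 2)) ≡⟨ upperSum-doubles undirected loopless _ sym-weight ⟩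
  edgeSum G (λ u v → scaledSqrt k (degree G u ^ 2 + degree G v ^ 2)) ≡⟨ edgeSum-cong G (λ {u} {v} _ → cong₂ (λ x y → scaledSqrt k (x ^ 2 + y ^ 2)) (degree≡deg G u) (degree≡deg G v)) ⟩
  edgeSum G (λ u v → scaledSqrt k (deg G u ^ 2 + deg G v ^ 2))     ∎
  where
  open ≡-Reasoning
  sym-weight : ∀ u v → scaledSqrt k (degree G u ^ 2 + degree G v ^ 2) ≡ scaledSqrt k (degree G v ^ 2 + degree G u ^ 2)
  sym-weight u v = cong (scaledSqrt k) (+-comm (degree G u ^ 2) _)

n<2^n : ∀ n → n < 2 ^ n
n<2^n zero    = s≤s z≤n
n<2^n (suc n) = +-mono-≤ (≤-trans (s≤s z≤n) (n<2^n n)) (≤-trans (n<2^n n) (m≤m+n (2 ^ n) 0))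

-- Charging the edges

-- The degree sequence of ℙₙ¹ when w is its pendant vertex and p the neighbour of w.
leafProfile : ∀ {n} → Fin n → Fin n → Fin n → ℕ
leafProfile w p u = if does (u ≟ w) then 1 else 2 + δ p u

module _ {n} {w p : Fin n} where

  leafProfile-leaf : leafProfile w p w ≡ 1
  leafProfile-leaf with w ≟ w
  ... | yes _  = refl
  ... | no w≢w = ⊥-elim (w≢w refl)

  leafProfile-other : ∀ {u} → ¬ u ≡ w → leafProfile w p u ≡ 2 + δ p u
  leafProfile-other {u} u≢w with u ≟ w
  ... | yes u≡w = ⊥-elim (u≢w u≡w)
  ... | no _    = refl

  leafProfile+δ : ¬ p ≡ w → ∀ u → leafProfile w p u + δ w u ≡ 2 + δ p u
  leafProfile+δ p≢w u with u ≟ w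
  ... | yes refl = cong (2 +_) (sym (δ-offdiag (p≢w ∘ sym)))
  ... | no _     = +-identityʳ _

sum-2+δ : ∀ {n} (c : Fin n) → ∑[ u < n ] (2 + δ c u) ≡ 2 * n + 1
sum-2+δ {n} c = trans (∑-distrib-+ (λ _ → 2) (δ c)) (cong₂ _+_ (trans (sum-const n 2) (*-comm n 2)) (sum-δ c))

sum-leafProfile : ∀ {n} {w p : Fin n} → ¬ p ≡ w → sum (leafProfile w p) ≡ 2 * n
sum-leafProfile {n} {w} {p} p≢w = +-cancelʳ-≡ 1 _ _ (begin
  sum (leafProfile w p) + 1                     ≡⟨ cong (sum (leafProfile w p) +_) (sum-δ w) ⟨
  sum (leafProfile w p) + sum (δ w)             ≡⟨ ∑-distrib-+ (leafProfile w p) (δ w) ⟨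
  ∑[ u < n ] (leafProfile w p u + δ w u)        ≡⟨ sum-cong-≗ (leafProfile+δ p≢w) ⟩
  ∑[ u < n ] (2 + δ p u)                        ≡⟨ sum-2+δ p ⟩
  2 * n + 1                                     ∎)
  where open ≡-Reasoning

module Weights (k : ℕ) where

  √8 √10 √13 β γ κ : ℕ
  √8 = scaledSqrt k 8
  √10 = scaledSqrt k 10
  √13 = scaledSqrt k 13
  β = √10 ∸ √8
  γ = √13 ∸ √10
  κ = β + γ

  √10≡√8+β : √10 ≡ √8 + β
  √10≡√8+β = sym (m+[n∸m]≡n (scaledSqrt-mono k (m≤m+n 8 2)))

  √13≡√10+γ : √13 ≡ √10 + γ
  √13≡√10+γ = sym (m+[n∸m]≡n (scaledSqrt-mono k (m≤m+n 10 3)))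

  √13≡√8+κ : √13 ≡ √8 + κ
  √13≡√8+κ = trans √13≡√10+γ (trans (cong (_+ γ) √10≡√8+β) (+-assoc √8 β γ))

  leaf-edge : √10 + γ * 1 ≡ √8 + κ * 1
  leaf-edge = trans (cong₂ _+_ √10≡√8+β (*-identityʳ γ)) (trans (+-assoc √8 β γ) (cong (√8 +_) (sym (*-identityʳ κ))))

  hubWeight : ∀ {n} {p u v : Fin n} → ¬ (u ≡ p × v ≡ p) →
    scaledSqrt k ((2 + δ p u) ^ 2 + (2 + δ p v) ^ 2) ≡ √8 + κ * (δ p u + δ p v)
  hubWeight {p = p} {u} {v} ¬pp with u ≟ p | v ≟ p
  ... | yes refl | yes refl = ⊥-elim (¬pp (refl , refl))
  ... | yes _    | no _     = trans √13≡√8+κ (cong (√8 +_) (sym (*-identityʳ κ)))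
  ... | no _     | yes _    = trans √13≡√8+κ (cong (√8 +_) (sym (*-identityʳ κ)))
  ... | no _     | no _     = sym (trans (cong (√8 +_) (*-zeroʳ κ)) (+-identityʳ √8))

  leafWeight : ∀ {n} {w p u v : Fin n} → ¬ p ≡ w → (u ≡ w → v ≡ p) → (v ≡ w → u ≡ p) → ¬ (u ≡ p × v ≡ p) →
    scaledSqrt k (leafProfile w p u ^ 2 + leafProfile w p v ^ 2) + γ * (δ w u + δ w v) ≡ √8 + κ * (δ p u + δ p v)
  leafWeight {w = w} {p} {u} {v} p≢w u-leaf v-leaf ¬pp with u ≟ w | v ≟ w
  ... | yes refl | yes refl = ⊥-elim (p≢w (sym (u-leaf refl)))
  ... | yes refl | no _ with refl ← u-leaf refl rewrite δ-diag p | δ-offdiag {c = p} (p≢w ∘ sym) = leaf-edge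
  ... | no _ | yes refl with refl ← v-leaf refl rewrite δ-diag p | δ-offdiag {c = p} (p≢w ∘ sym) = leaf-edge
  ... | no _ | no _ = trans (cong (x +_) (*-zeroʳ γ)) (trans (+-identityʳ x) (hubWeight ¬pp))
    where x = scaledSqrt k ((2 + δ p u) ^ 2 + (2 + δ p v) ^ 2)

  module _ {n} {G : Graph n} (undirected : Undirected G) (loopless : Loopless G) where

    edgeSum-hubWeight : ∀ h → edgeSum G (λ u v → scaledSqrt k ((2 + δ h u) ^ 2 + (2 + δ h v) ^ 2)) ≡
                              √8 * degSum G + κ * (deg G h + deg G h)
    edgeSum-hubWeight h = trans (edgeSum-cong G (λ {u} {v} e → hubWeight {p = h} {u} {v} (λ (u≡h , v≡h) → edge⇒≢ {G = G} loopless e (trans u≡h (sym v≡h)))))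
                                (edgeSum-affine G undirected √8 κ h)

    edgeSum-leafWeight : ∀ {w p} → G w p ≡ true → (∀ y → G w y ≡ true → y ≡ p) →
      edgeSum G (λ u v → scaledSqrt k (leafProfile w p u ^ 2 + leafProfile w p v ^ 2)) + γ * (deg G w + deg G w) ≡
      √8 * degSum G + κ * (deg G p + deg G p)
    edgeSum-leafWeight {w} {p} wp only-w = begin
      edgeSum G ℓ-weight + γ * (deg G w + deg G w)                            ≡⟨ cong (edgeSum G ℓ-weight +_) (cong (γ *_) (edgeSum-δ G undirected w)) ⟨
      edgeSum G ℓ-weight + γ * edgeSum G (λ u v → δ w u + δ w v)             ≡⟨ cong (edgeSum G ℓ-weight +_) (edgeSum-*ˡ G γ _) ⟨
      edgeSum G ℓ-weight + edgeSum G (λ u v → γ * (δ w u + δ w v))           ≡⟨ edgeSum-+ G ℓ-weight _ ⟨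
      edgeSum G (λ u v → ℓ-weight u v + γ * (δ w u + δ w v))                 ≡⟨ edgeSum-cong G weight ⟩
      edgeSum G (λ u v → √8 + κ * (δ p u + δ p v))                            ≡⟨ edgeSum-affine G undirected √8 κ p ⟩
      √8 * degSum G + κ * (deg G p + deg G p)                                  ∎
      where
      open ≡-Reasoning
      ℓ-weight : Fin n → Fin n → ℕ
      ℓ-weight u v = scaledSqrt k (leafProfile w p u ^ 2 + leafProfile w p v ^ 2)
      p≢w : ¬ p ≡ w
      p≢w p≡w = edge⇒≢ loopless wp (sym p≡w)
      weight : ∀ {u v} → G u v ≡ true → ℓ-weight u v + γ * (δ w u + δ w v) ≡ √8 + κ * (δ p u + δ p v)
      weight {u} {v} e = leafWeight {u = u} {v} p≢w (λ { refl → only-w v e }) (λ { refl → only-w u (edge-sym undirected e) })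
                                     (λ (u≡p , v≡p) → edge⇒≢ {G = G} loopless e (trans u≡p (sym v≡p)))

listSum-replicate-++ : ∀ (φ : ℕ → ℕ) m t ys → List.sum (map φ (replicate m t ++ ys)) ≡ m * φ t + List.sum (map φ ys)
listSum-replicate-++ φ zero    t ys = refl
listSum-replicate-++ φ (suc m) t ys = trans (cong (φ t +_) (listSum-replicate-++ φ m t ys)) (sym (+-assoc (φ t) _ _))

length-somborBound : ∀ n → 3 ≤ n → length (somborBound n) ≡ n
length-somborBound n 3≤n = trans (length-++ (n ∸ 3)) (m∸n+n≡m 3≤n)
  where
  length-++ : ∀ m → length (replicate m 8 ++ 10 ∷ 13 ∷ 13 ∷ []) ≡ m + 3
  length-++ zero    = refl
  length-++ (suc m) = cong suc (length-++ m)

module _ (k : ℕ) where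
  open Weights k

  twice-approx-somborBound : ∀ n → 3 ≤ n → ∀ e → 2 * approx k (somborBound n) + √8 * e + γ * 2 ≡ √8 * (2 * n + e) + κ * 6
  twice-approx-somborBound n 3≤n e = begin
    2 * approx k (somborBound n) + √8 * e + γ * 2
      ≡⟨ cong (λ t → 2 * t + √8 * e + γ * 2) (listSum-replicate-++ (scaledSqrt k) (n ∸ 3) 8 (10 ∷ 13 ∷ 13 ∷ [])) ⟩
    2 * ((n ∸ 3) * √8 + (√10 + (√13 + (√13 + 0)))) + √8 * e + γ * 2
      ≡⟨ cong₂ (λ x y → 2 * ((n ∸ 3) * √8 + (x + (y + (y + 0)))) + √8 * e + γ * 2) √10≡√8+β √13≡√8+κ ⟩
    2 * ((n ∸ 3) * √8 + ((√8 + β) + ((√8 + κ) + ((√8 + κ) + 0)))) + √8 * e + γ * 2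
      ≡⟨ identity (n ∸ 3) √8 β γ e ⟩
    √8 * (2 * (n ∸ 3 + 3) + e) + κ * 6
      ≡⟨ cong (λ m → √8 * (2 * m + e) + κ * 6) (m∸n+n≡m 3≤n) ⟩
    √8 * (2 * n + e) + κ * 6 ∎
    where
    open ≡-Reasoning
    identity : ∀ m a β γ e → 2 * (m * a + ((a + β) + ((a + (β + γ)) + ((a + (β + γ)) + 0)))) + a * e + γ * 2 ≡
                             a * (2 * (m + 3) + e) + (β + γ) * 6
    identity = solve-∀

record P1Degrees {n} (G : Graph n) : Set where
  field
    leaf hub : Fin n
    leaf-hub : G leaf hub ≡ true
    degrees  : ∀ u → deg G u ≡ leafProfile leaf hub u

module _ {n} {G : Graph n} (undirected : Undirected G) (loopless : Loopless G) where

  profile-sombor≤ : ∀ k (ℓ : Fin n → ℕ) → (∀ u → ℓ u ≤ deg G u) →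
    edgeSum G (λ u v → scaledSqrt k (ℓ u ^ 2 + ℓ v ^ 2)) ≤ 2 * approx k (somborTerms G)
  profile-sombor≤ k ℓ ℓ≤deg = ≤-trans
    (edgeSum-mono G λ {u} {v} _ → scaledSqrt-mono k (+-mono-≤ (square-mono (ℓ≤deg u)) (square-mono (ℓ≤deg v))))
    (≤-reflexive (sym (twice-approx-somborTerms undirected loopless k)))
    where
    square-mono : ∀ {x y} → x ≤ y → x ^ 2 ≤ y ^ 2
    square-mono x≤y = *-mono-≤ x≤y (*-mono-≤ x≤y ≤-refl)

  P1Degrees⇒approx≡ : P1Degrees G → 3 ≤ n → ∀ k → approx k (somborTerms G) ≡ approx k (somborBound n)
  P1Degrees⇒approx≡ P 3≤n k = *-cancelˡ-≡ _ _ 2 (+-cancelʳ-≡ (γ * 2) _ _ (begin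
    2 * approx k (somborTerms G) + γ * 2
      ≡⟨ cong₂ _+_ (twice-approx-somborTerms undirected loopless k) (cong (λ d → γ * (d + d)) (sym dw)) ⟩
    edgeSum G (λ u v → scaledSqrt k (deg G u ^ 2 + deg G v ^ 2)) + γ * (deg G w + deg G w)
      ≡⟨ cong (_+ γ * (deg G w + deg G w)) (edgeSum-cong G λ {u} {v} _ → cong₂ (λ x y → scaledSqrt k (x ^ 2 + y ^ 2)) (degrees u) (degrees v)) ⟩
    edgeSum G (λ u v → scaledSqrt k (leafProfile w p u ^ 2 + leafProfile w p v ^ 2)) + γ * (deg G w + deg G w)
      ≡⟨ edgeSum-leafWeight undirected loopless leaf-hub (λ y → count≤1⇒≡ {b = G w} (≤-reflexive dw) leaf-hub) ⟩
    √8 * degSum G + κ * (deg G p + deg G p)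
      ≡⟨ cong₂ (λ D d → √8 * D + κ * (d + d)) (trans (sum-cong-≗ {x = deg G} degrees) (sum-leafProfile p≢w)) dp ⟩
    √8 * (2 * n) + κ * 6
      ≡⟨ cong (λ m → √8 * m + κ * 6) (+-identityʳ (2 * n)) ⟨
    √8 * (2 * n + 0) + κ * 6
      ≡⟨ twice-approx-somborBound k n 3≤n 0 ⟨
    2 * approx k (somborBound n) + √8 * 0 + γ * 2
      ≡⟨ cong (_+ γ * 2) (trans (cong (2 * approx k (somborBound n) +_) (*-zeroʳ √8)) (+-identityʳ _)) ⟩
    2 * approx k (somborBound n) + γ * 2 ∎))
    where
    open ≡-Reasoning
    open Weights k
    open P1Degrees P renaming (leaf to w; hub to p)
    p≢w : ¬ p ≡ w
    p≢w p≡w = edge⇒≢ loopless leaf-hub (sym p≡w)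
    dw : deg G w ≡ 1
    dw = trans (degrees w) (leafProfile-leaf {w = w} {p = p})
    dp : deg G p ≡ 3
    dp = trans (degrees p) (trans (leafProfile-other {w = w} p≢w) (cong (2 +_) (δ-diag p)))

module SomborBound {n} (G : Graph n) (undirected : Undirected G) (loopless : Loopless G)
                   (connected : Connected G) (one-bridge : ExactlyOneBridge G) (3≤n : 3 ≤ n) where

  open OneBridge G undirected loopless connected one-bridge 3≤n

  leafProfile≤deg : ∀ {w p} → deg G w ≡ 1 → 3 ≤ deg G p → (∀ u → ¬ u ≡ w → 2 ≤ deg G u) →
    ∀ u → leafProfile w p u ≤ deg G u
  leafProfile≤deg {w} {p} dw dp others u with u ≟ w
  ... | yes refl = ≤-reflexive (sym dw)
  ... | no u≢w with u ≟ p
  ...   | yes refl = dp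
  ...   | no _     = others u u≢w

  hubProfile≤deg : ∀ {h} → 3 ≤ deg G h → (∀ u → 2 ≤ deg G u) → ∀ u → 2 + δ h u ≤ deg G u
  hubProfile≤deg {h} dh all≥2 u with u ≟ h
  ... | yes refl = dh
  ... | no _     = all≥2 u

  excess : Shape → ℕ
  excess (pendant _ _ _ _ _ _) = 0
  excess (noPendant _ _ _)     = 1

  degSum-lower : ∀ s → 2 * n + excess s ≤ degSum G
  degSum-lower (pendant w p wp dw dp others) = subst (_≤ degSum G) (trans (sum-leafProfile p≢w) (sym (+-identityʳ _)))
    (sum-mono-≤ (leafProfile≤deg dw dp others))
    where p≢w = λ p≡w → edge⇒≢ loopless wp (sym p≡w)
  degSum-lower (noPendant h dh all≥2) = subst (_≤ degSum G) (sum-2+δ h) (sum-mono-≤ (hubProfile≤deg dh all≥2))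

  charge : Shape → ∀ k → let open Weights k in √8 * degSum G + κ * 6 ≤ 2 * approx k (somborTerms G) + γ * 2
  charge (pendant w p wp dw dp others) k = begin
    √8 * degSum G + κ * 6                               ≤⟨ +-monoʳ-≤ (√8 * degSum G) (*-monoʳ-≤ κ (+-mono-≤ dp dp)) ⟩
    √8 * degSum G + κ * (deg G p + deg G p)             ≡⟨ edgeSum-leafWeight undirected loopless wp (λ y → count≤1⇒≡ {b = G w} (≤-reflexive dw) wp) ⟨
    edgeSum G ℓ-weight + γ * (deg G w + deg G w)       ≤⟨ +-mono-≤ (profile-sombor≤ undirected loopless k _ (leafProfile≤deg dw dp others))
                                                                     (≤-reflexive (cong (λ d → γ * (d + d)) dw)) ⟩
    2 * approx k (somborTerms G) + γ * 2               ∎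
    where
    open Weights k
    open ≤-Reasoning
    ℓ-weight = λ u v → scaledSqrt k (leafProfile w p u ^ 2 + leafProfile w p v ^ 2)
  charge (noPendant h dh all≥2) k = begin
    √8 * degSum G + κ * 6                               ≤⟨ +-monoʳ-≤ (√8 * degSum G) (*-monoʳ-≤ κ (+-mono-≤ dh dh)) ⟩
    √8 * degSum G + κ * (deg G h + deg G h)             ≡⟨ edgeSum-hubWeight undirected loopless h ⟨
    edgeSum G (λ u v → scaledSqrt k ((2 + δ h u) ^ 2 + (2 + δ h v) ^ 2))
                                                       ≤⟨ profile-sombor≤ undirected loopless k _ (hubProfile≤deg dh all≥2) ⟩
    2 * approx k (somborTerms G)                       ≤⟨ m≤m+n _ (γ * 2) ⟩
    2 * approx k (somborTerms G) + γ * 2               ∎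
    where
    open Weights k
    open ≤-Reasoning

  sombor≥ : ∀ k e → 2 * n + e ≤ degSum G →
    let open Weights k in 2 * approx k (somborBound n) + √8 * e ≤ 2 * approx k (somborTerms G)
  sombor≥ k e 2n+e≤D = +-cancelʳ-≤ (γ * 2) _ _ (begin
    2 * approx k (somborBound n) + √8 * e + γ * 2      ≡⟨ twice-approx-somborBound k n 3≤n e ⟩
    √8 * (2 * n + e) + κ * 6                           ≤⟨ +-monoˡ-≤ (κ * 6) (*-monoʳ-≤ √8 2n+e≤D) ⟩
    √8 * degSum G + κ * 6                              ≤⟨ charge shape k ⟩
    2 * approx k (somborTerms G) + γ * 2               ∎)
    where
    open Weights k
    open ≤-Reasoning

  somborBound≤√somborTerms : somborBound n ≤√ somborTerms G
  somborBound≤√somborTerms k = ≤-trans (*-cancelˡ-≤ 2 (≤-trans (m≤m+n _ (√8 * 0)) (sombor≥ k 0 2n≤D)))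
                                       (m≤m+n (approx k (somborTerms G)) _)
    where
    open Weights k
    2n≤D = ≤-trans (+-monoʳ-≤ (2 * n) z≤n) (degSum-lower shape)

  -- At precision k = n one unit of degree sum beyond 2n is worth √8 ≥ 2·2ⁿ, more than the rounding slack 2n.
  degSum>2n⇒¬≤√ : 2 * n + 1 ≤ degSum G → ¬ (somborTerms G ≤√ somborBound n)
  degSum>2n⇒¬≤√ 2n<D terms≤bound =
    <⇒≱ (<-≤-trans (*-monoʳ-< 2 (n<1+n n)) (≤-trans (*-monoʳ-≤ 2 (n<2^n n)) (scaledSqrt-8 n))) √8≤2n
    where
    open Weights n
    AB = approx n (somborBound n)
    AT≤AB+n : approx n (somborTerms G) ≤ AB + n
    AT≤AB+n = subst (λ m → approx n (somborTerms G) ≤ AB + m) (length-somborBound n 3≤n) (terms≤bound n)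
    √8≤2n : √8 ≤ 2 * n
    √8≤2n = +-cancelˡ-≤ (2 * AB) _ _ (begin
      2 * AB + √8                           ≡⟨ cong (2 * AB +_) (*-identityʳ √8) ⟨
      2 * AB + √8 * 1                       ≤⟨ sombor≥ n 1 2n<D ⟩
      2 * approx n (somborTerms G)          ≤⟨ *-monoʳ-≤ 2 AT≤AB+n ⟩
      2 * (AB + n)                          ≡⟨ *-distribˡ-+ 2 AB n ⟩
      2 * AB + 2 * n                        ∎)
      where open ≤-Reasoning

  ≤√⇒P1Degrees : somborTerms G ≤√ somborBound n → P1Degrees G
  ≤√⇒P1Degrees terms≤bound with shape
  ... | s@(noPendant _ _ _) = ⊥-elim (degSum>2n⇒¬≤√ (degSum-lower s) terms≤bound)
  ... | pendant w p wp dw dp others = record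
    { leaf = w ; hub = p ; leaf-hub = wp
    ; degrees = λ u → sym (sum-squeeze (leafProfile≤deg dw dp others) D≤ u) }
    where
    D≤ : degSum G ≤ sum (leafProfile w p)
    D≤ with degSum G ≤? 2 * n
    ... | yes D≤2n = subst (degSum G ≤_) (sym (sum-leafProfile (λ p≡w → edge⇒≢ loopless wp (sym p≡w)))) D≤2n
    ... | no  D≰2n = ⊥-elim (degSum>2n⇒¬≤√ (subst (_≤ degSum G) (+-comm 1 (2 * n)) (≰⇒> D≰2n)) terms≤bound)

-- The graph ℙₙ¹

Cyc : ℕ → ℕ → ℕ → Set
Cyc n i j = i < n ∸ 1 × j < n ∸ 1 × (j ≡ suc i ⊎ i ≡ 0 × j ≡ n ∸ 2)

Pend : ℕ → ℕ → ℕ → Set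
Pend n i j = i ≡ n ∸ 1 × j ≡ 0

Adj : ℕ → ℕ → ℕ → Set
Adj n i j = Cyc n i j ⊎ Cyc n j i ⊎ Pend n i j ⊎ Pend n j i

≡ᵇ⇔≡ : ∀ {i j} → T (i ≡ᵇ j) ⇔ i ≡ j
≡ᵇ⇔≡ {i} {j} = mk⇔ (≡ᵇ⇒≡ i j) (≡⇒≡ᵇ i j)

<ᵇ⇔< : ∀ {i j} → T (i <ᵇ j) ⇔ i < j
<ᵇ⇔< {i} {j} = mk⇔ (<ᵇ⇒< i j) <⇒<ᵇ

cycAdj⇔Cyc : ∀ n i j → T (cycAdj n i j) ⇔ Cyc n i j
cycAdj⇔Cyc n i j = (<ᵇ⇔< ×-⇔ (<ᵇ⇔< ×-⇔ (≡ᵇ⇔≡ ⊎-⇔ (≡ᵇ⇔≡ ×-⇔ ≡ᵇ⇔≡) ⇔-∘ T-∧) ⇔-∘ T-∨) ⇔-∘ T-∧) ⇔-∘ T-∧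

pendAdj⇔Pend : ∀ n i j → T (pendAdj n i j) ⇔ Pend n i j
pendAdj⇔Pend n i j = (≡ᵇ⇔≡ ×-⇔ ≡ᵇ⇔≡) ⇔-∘ T-∧

P1⇔Adj : ∀ n (u v : Fin n) → P1 n u v ≡ true ⇔ Adj n (toℕ u) (toℕ v)
P1⇔Adj n u v =
  ((cycAdj⇔Cyc n _ _ ⊎-⇔ (cycAdj⇔Cyc n _ _ ⊎-⇔ (pendAdj⇔Pend n _ _ ⊎-⇔ pendAdj⇔Pend n _ _) ⇔-∘ T-∨) ⇔-∘ T-∨) ⇔-∘ T-∨)
    ⇔-∘ ⇔-sym T-≡

Adj-sym : ∀ {n i j} → Adj n i j → Adj n j i
Adj-sym (inj₁ c)               = inj₂ (inj₁ c)
Adj-sym (inj₂ (inj₁ c))        = inj₁ c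
Adj-sym (inj₂ (inj₂ (inj₁ p))) = inj₂ (inj₂ (inj₂ p))
Adj-sym (inj₂ (inj₂ (inj₂ p))) = inj₂ (inj₂ (inj₁ p))

-- Vertex counts are written 4 + m so that n ∸ 1 and n ∸ 2 compute.
module _ {m : ℕ} where

  Adj-from-last : ∀ {j} → Adj (4 + m) (3 + m) j → j ≡ 0
  Adj-from-last (inj₁ (l , _))                 = ⊥-elim (n≮n _ l)
  Adj-from-last (inj₂ (inj₁ (_ , l , _)))      = ⊥-elim (n≮n _ l)
  Adj-from-last (inj₂ (inj₂ (inj₁ (_ , j≡0)))) = j≡0
  Adj-from-last (inj₂ (inj₂ (inj₂ (_ , ()))))

  Adj-from-0 : ∀ {j} → Adj (4 + m) 0 j → j ≡ 1 ⊎ j ≡ 2 + m ⊎ j ≡ 3 + m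
  Adj-from-0 (inj₁ (_ , _ , inj₁ j≡1))              = inj₁ j≡1
  Adj-from-0 (inj₁ (_ , _ , inj₂ (_ , j≡2+m)))      = inj₂ (inj₁ j≡2+m)
  Adj-from-0 (inj₂ (inj₁ (_ , _ , inj₁ ())))
  Adj-from-0 (inj₂ (inj₁ (_ , _ , inj₂ (_ , ()))))
  Adj-from-0 (inj₂ (inj₂ (inj₁ (() , _))))
  Adj-from-0 (inj₂ (inj₂ (inj₂ (j≡3+m , _))))       = inj₂ (inj₂ j≡3+m)

  Adj-from-inner : ∀ {i j} → 1 ≤ i → i < 3 + m → Adj (4 + m) i j →
    j ≡ pred i ⊎ (j ≡ suc i × suc i < 3 + m) ⊎ (j ≡ 0 × i ≡ 2 + m)
  Adj-from-inner _   _   (inj₁ (_ , j<3+m , inj₁ refl))   = inj₂ (inj₁ (refl , j<3+m))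
  Adj-from-inner ()  _   (inj₁ (_ , _ , inj₂ (refl , _)))
  Adj-from-inner _   _   (inj₂ (inj₁ (_ , _ , inj₁ refl))) = inj₁ refl
  Adj-from-inner _   _   (inj₂ (inj₁ (_ , _ , inj₂ (j≡0 , i≡2+m)))) = inj₂ (inj₂ (j≡0 , i≡2+m))
  Adj-from-inner _   i<  (inj₂ (inj₂ (inj₁ (refl , _))))   = ⊥-elim (n≮n _ i<)
  Adj-from-inner ()  _   (inj₂ (inj₂ (inj₂ (_ , refl))))

  Adj-last-0 : Adj (4 + m) (3 + m) 0
  Adj-last-0 = inj₂ (inj₂ (inj₁ (refl , refl)))

  Adj-0-1 : Adj (4 + m) 0 1
  Adj-0-1 = inj₁ (s≤s z≤n , s≤s (s≤s z≤n) , inj₁ refl)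

  Adj-0-2+m : Adj (4 + m) 0 (2 + m)
  Adj-0-2+m = inj₁ (s≤s z≤n , ≤-refl , inj₂ (refl , refl))

  Adj-pred : ∀ {i} → 1 ≤ i → i < 3 + m → Adj (4 + m) i (pred i)
  Adj-pred {suc i} _ i< = inj₂ (inj₁ (<-trans (n<1+n i) i< , i< , inj₁ refl))

  Adj-suc : ∀ {i} → suc i < 3 + m → Adj (4 + m) i (suc i)
  Adj-suc {i} i+1< = inj₁ (<-trans (n<1+n i) i+1< , i+1< , inj₁ refl)

  private
    n = 4 + m

  vertex : ∀ i → i < n → Fin n
  vertex i i<n = fromℕ< i<n

  P1-edge : ∀ {u v : Fin n} → Adj n (toℕ u) (toℕ v) → P1 n u v ≡ true
  P1-edge {u} {v} = Equivalence.from (P1⇔Adj n u v)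

  P1-adj : ∀ {u v : Fin n} → P1 n u v ≡ true → Adj n (toℕ u) (toℕ v)
  P1-adj {u} {v} = Equivalence.to (P1⇔Adj n u v)

  P1-edge-vertex : ∀ {i j} (i<n : i < n) (j<n : j < n) → Adj n i j → P1 n (vertex i i<n) (vertex j j<n) ≡ true
  P1-edge-vertex i<n j<n = P1-edge ∘ subst₂ (Adj n) (sym (toℕ-fromℕ< i<n)) (sym (toℕ-fromℕ< j<n))

  toℕ⇒vertex : ∀ {y : Fin n} {i} (i<n : i < n) → toℕ y ≡ i → y ≡ vertex i i<n
  toℕ⇒vertex i<n e = toℕ-injective (trans e (sym (toℕ-fromℕ< i<n)))

  vertex-injective : ∀ {i j} (i<n : i < n) (j<n : j < n) → vertex i i<n ≡ vertex j j<n → i ≡ j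
  vertex-injective i<n j<n e = trans (sym (toℕ-fromℕ< i<n)) (trans (cong toℕ e) (toℕ-fromℕ< j<n))

  private
    0<n : 0 < n
    0<n = s≤s z≤n
    1<n : 1 < n
    1<n = s≤s (s≤s z≤n)
    2+m<n : 2 + m < n
    2+m<n = s≤s (n≤1+n (2 + m))
    3+m<n : 3 + m < n
    3+m<n = ≤-refl
    hub leaf : Fin n
    hub = vertex 0 0<n
    leaf = vertex (3 + m) 3+m<n

  vertex-≢ : ∀ {i j} (i<n : i < n) (j<n : j < n) → ¬ i ≡ j → ¬ vertex i i<n ≡ vertex j j<n
  vertex-≢ i<n j<n i≢j = i≢j ∘ vertex-injective i<n j<n

  pred<n : ∀ (u : Fin n) → pred (toℕ u) < n
  pred<n u = ≤-<-trans pred[n]≤n (toℕ<n u)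

  P1-edge-to : ∀ {u : Fin n} {j} (j<n : j < n) → Adj n (toℕ u) j → P1 n u (vertex j j<n) ≡ true
  P1-edge-to j<n = P1-edge ∘ subst (Adj n _) (sym (toℕ-fromℕ< j<n))

  P1-inner-deg : ∀ {u : Fin n} → 1 ≤ toℕ u → toℕ u < 3 + m → deg (P1 n) u ≡ 2
  P1-inner-deg {u} 1≤I I<3+m with toℕ u ≟ℕ 2 + m
  ... | yes I≡2+m = count≡2 {b = P1 n u} (P1-edge-to (pred<n u) (Adj-pred 1≤I I<3+m)) (P1-edge-to 0<n Adj-to-0)
                      (vertex-≢ 0<n (pred<n u) (λ 0≡pI → 1+m≢0 (trans (cong pred (sym I≡2+m)) (sym 0≡pI)))) nbrs
    where
    1+m≢0 : ¬ suc m ≡ 0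
    1+m≢0 ()
    Adj-to-0 : Adj n (toℕ u) 0
    Adj-to-0 = subst (λ i → Adj n i 0) (sym I≡2+m) (Adj-sym {n} Adj-0-2+m)
    nbrs : ∀ y → P1 n u y ≡ true → y ≡ vertex (pred (toℕ u)) (pred<n u) ⊎ y ≡ hub
    nbrs y e with Adj-from-inner 1≤I I<3+m (P1-adj e)
    ... | inj₁ y≡pI               = inj₁ (toℕ⇒vertex (pred<n u) y≡pI)
    ... | inj₂ (inj₁ (_ , sI<))   = ⊥-elim (n≮n _ (subst (λ i → suc i < 3 + m) I≡2+m sI<))
    ... | inj₂ (inj₂ (y≡0 , _))   = inj₂ (toℕ⇒vertex 0<n y≡0)
  ... | no I≢2+m = count≡2 {b = P1 n u} (P1-edge-to (pred<n u) (Adj-pred 1≤I I<3+m)) (P1-edge-to sI<n (Adj-suc sI<3+m))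
                     (vertex-≢ sI<n (pred<n u) (pred≢suc (toℕ u) ∘ sym)) nbrs
    where
    sI<3+m : suc (toℕ u) < 3 + m
    sI<3+m = ≤∧≢⇒< I<3+m (I≢2+m ∘ suc-injective)
    sI<n : suc (toℕ u) < n
    sI<n = <-trans sI<3+m 3+m<n
    pred≢suc : ∀ i → ¬ pred i ≡ suc i
    pred≢suc zero    ()
    pred≢suc (suc i) ()
    nbrs : ∀ y → P1 n u y ≡ true → y ≡ vertex (pred (toℕ u)) (pred<n u) ⊎ y ≡ vertex (suc (toℕ u)) sI<n
    nbrs y e with Adj-from-inner 1≤I I<3+m (P1-adj e)
    ... | inj₁ y≡pI               = inj₁ (toℕ⇒vertex (pred<n u) y≡pI)
    ... | inj₂ (inj₁ (y≡sI , _))  = inj₂ (toℕ⇒vertex sI<n y≡sI)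
    ... | inj₂ (inj₂ (_ , I≡2+m)) = ⊥-elim (I≢2+m I≡2+m)

  P1-degrees : P1Degrees (P1 n)
  P1-degrees = record { leaf = leaf ; hub = hub ; leaf-hub = leaf-hub ; degrees = degrees }
    where
    leaf-hub = P1-edge-vertex 3+m<n 0<n Adj-last-0
    degrees : ∀ u → deg (P1 n) u ≡ leafProfile leaf hub u
    degrees u with u ≟ leaf
    ... | yes refl = count≡1 {b = P1 n leaf} leaf-hub λ y e →
      toℕ⇒vertex 0<n (Adj-from-last (subst (λ i → Adj n i (toℕ y)) (toℕ-fromℕ< 3+m<n) (P1-adj e)))
    ... | no u≢leaf with u ≟ hub
    ...   | yes refl = count≡3 {b = P1 n hub} (P1-edge-vertex 0<n 1<n Adj-0-1) (P1-edge-vertex 0<n 2+m<n Adj-0-2+m)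
                               (P1-edge-vertex 0<n 3+m<n (Adj-sym {n} Adj-last-0))
                               (vertex-≢ 2+m<n 1<n λ ()) (vertex-≢ 3+m<n 1<n λ ()) (vertex-≢ 3+m<n 2+m<n (λ ()))
                               nbrs
      where
      nbrs : ∀ y → P1 n hub y ≡ true → y ≡ vertex 1 1<n ⊎ y ≡ vertex (2 + m) 2+m<n ⊎ y ≡ leaf
      nbrs y e with Adj-from-0 (P1-adj e)
      ... | inj₁ y≡1             = inj₁ (toℕ⇒vertex 1<n y≡1)
      ... | inj₂ (inj₁ y≡2+m)    = inj₂ (inj₁ (toℕ⇒vertex 2+m<n y≡2+m))
      ... | inj₂ (inj₂ y≡3+m)    = inj₂ (inj₂ (toℕ⇒vertex 3+m<n y≡3+m))
    ...   | no u≢hub = P1-inner-deg (n≢0⇒n>0 (u≢hub ∘ toℕ-injective))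
                                    (≤∧≢⇒< (s≤s⁻¹ (toℕ<n u)) (u≢leaf ∘ toℕ⇒vertex 3+m<n))

-- Graphs with the degrees of ℙₙ¹

module _ {n} {G H : Graph n} (iso : G ≅ H) where

  open Inverse (⤖⇒↔ (proj₁ iso))

  deg-≅ : ∀ u → deg G u ≡ deg H (to u)
  deg-≅ u = trans (sum-cong-≗ λ v → cong ι (proj₂ iso u v)) (sym (sum-permute (λ v → ι (H (to u) v)) (⤖⇒↔ (proj₁ iso))))

  does-≟-from : ∀ u w → does (to u ≟ w) ≡ does (u ≟ from w)
  does-≟-from u w with to u ≟ w | u ≟ from w
  ... | yes _    | yes _    = refl
  ... | no _     | no _     = refl
  ... | yes refl | no u≢    = ⊥-elim (u≢ (sym (strictlyInverseʳ u)))
  ... | no ≢w    | yes refl = ⊥-elim (≢w (strictlyInverseˡ w))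

  leafProfile-≅ : ∀ w p u → leafProfile w p (to u) ≡ leafProfile (from w) (from p) u
  leafProfile-≅ w p u rewrite does-≟-from u w | does-≟-from u p = refl

  P1Degrees-≅ : P1Degrees H → P1Degrees G
  P1Degrees-≅ record { leaf = w ; hub = p ; leaf-hub = wp ; degrees = degrees } = record
    { leaf     = from w
    ; hub      = from p
    ; leaf-hub = trans (proj₂ iso (from w) (from p)) (subst₂ (λ x y → H x y ≡ true) (sym (strictlyInverseˡ w)) (sym (strictlyInverseˡ p)) wp)
    ; degrees  = λ u → trans (deg-≅ u) (trans (degrees (to u)) (leafProfile-≅ w p u))
    }

module Walk {n} (G : Graph n) (undirected : Undirected G) (loopless : Loopless G) (P : P1Degrees G) where

  open P1Degrees P renaming (leaf to w; hub to p; leaf-hub to wp)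

  p≢w : ¬ p ≡ w
  p≢w p≡w = edge⇒≢ loopless wp (sym p≡w)

  only-w : ∀ {y} → G w y ≡ true → y ≡ p
  only-w = count≤1⇒≡ {b = G w} (≤-reflexive (trans (degrees w) (leafProfile-leaf {w = w} {p = p}))) wp

  deg-hub : deg G p ≡ 3
  deg-hub = trans (degrees p) (trans (leafProfile-other {w = w} p≢w) (cong (2 +_) (δ-diag p)))

  deg-inner : ∀ {u} → ¬ u ≡ w → ¬ u ≡ p → deg G u ≡ 2
  deg-inner u≢w u≢p = trans (degrees _) (trans (leafProfile-other {p = p} u≢w) (cong (2 +_) (δ-offdiag u≢p)))

  Step : Fin n → Fin n → Fin n → Set
  Step prev cur y = G cur y ≡ true × ¬ y ≡ prev × ¬ y ≡ w

  step? : ∀ prev cur y → Dec (Step prev cur y)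
  step? prev cur y = (G cur y Bool.≟ true) ×-dec ¬? (y ≟ prev) ×-dec ¬? (y ≟ w)

  next : Fin n → Fin n → Fin n
  next prev cur with any? (step? prev cur)
  ... | yes (y , _) = y
  ... | no _        = cur

  next-step : ∀ {prev cur} → ∃ (Step prev cur) → Step prev cur (next prev cur)
  next-step {prev} {cur} ∃step with any? (step? prev cur)
  ... | yes (_ , s) = s
  ... | no ∄step    = ⊥-elim (∄step ∃step)

  inner-step : ∀ {prev cur} → ¬ cur ≡ w → ¬ cur ≡ p → G cur prev ≡ true → Step prev cur (next prev cur)
  inner-step {prev} {cur} cur≢w cur≢p cur-prev
    with y , cy , y≢prev ← count≥2⇒∃≢ {b = G cur} (≤-reflexive (sym (deg-inner cur≢w cur≢p))) cur-prev =
    next-step (y , cy , y≢prev , λ y≡w → cur≢p (only-w (edge-sym undirected (subst (λ z → G cur z ≡ true) y≡w cy))))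

  inner-nbrs : ∀ {u y₁ y₂ y} → ¬ u ≡ w → ¬ u ≡ p → G u y₁ ≡ true → G u y₂ ≡ true → ¬ y₂ ≡ y₁ →
    G u y ≡ true → y ≡ y₁ ⊎ y ≡ y₂
  inner-nbrs {u} u≢w u≢p = count≤2⇒⊎ {b = G u} (≤-reflexive (deg-inner u≢w u≢p))

  hub-other : ∃ λ a → G p a ≡ true × ¬ a ≡ w
  hub-other = count≥2⇒∃≢ {b = G p} (subst (2 ≤_) (sym deg-hub) (n≤1+n 2)) (edge-sym undirected wp)

  hub-third : ∀ {a} → G p a ≡ true → ¬ a ≡ w → ∃ λ b → G p b ≡ true × ¬ b ≡ w × ¬ b ≡ a
  hub-third pa a≢w = count≥3⇒∃≢≢ {b = G p} (≤-reflexive (sym deg-hub)) (edge-sym undirected wp) pa a≢w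

  module FromHub (a : Fin n) (pa : G p a ≡ true) (a≢w : ¬ a ≡ w) where

    walk : ℕ → Fin n × Fin n
    walk zero    = p , a
    walk (suc k) = proj₂ (walk k) , next (proj₁ (walk k)) (proj₂ (walk k))

    x : ℕ → Fin n
    x k = proj₁ (walk k)

    AvoidsHub : ℕ → Set
    AvoidsHub j = ∀ {i} → 1 ≤ i → i ≤ j → ¬ x i ≡ p

    avoidsHub-≤ : ∀ {j j′} → j′ ≤ j → AvoidsHub j → AvoidsHub j′
    avoidsHub-≤ j′≤j avoid 1≤i i≤j′ = avoid 1≤i (≤-trans i≤j′ j′≤j)

    leaves-leaf : ∀ k → AvoidsHub k → G (x k) (x (suc k)) ≡ true → ¬ x (suc k) ≡ w
    leaves-leaf zero    _     _    = a≢w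
    leaves-leaf (suc k) avoid edge x≡w =
      avoid (s≤s z≤n) ≤-refl (only-w (edge-sym undirected (subst (λ z → G (x (suc k)) z ≡ true) x≡w edge)))

    walk-edge : ∀ k → AvoidsHub k → ¬ x k ≡ w × G (x k) (x (suc k)) ≡ true
    walk-edge zero    _     = p≢w , pa
    walk-edge (suc k) avoid with _ , edge ← walk-edge k (avoidsHub-≤ (n≤1+n k) avoid) =
      x′≢w , proj₁ (inner-step x′≢w (avoid (s≤s z≤n) ≤-refl) (edge-sym undirected edge))
      where x′≢w = leaves-leaf k (avoidsHub-≤ (n≤1+n k) avoid) edge

    no-backtrack : ∀ k → AvoidsHub (suc k) → ¬ x (suc (suc k)) ≡ x k
    no-backtrack k avoid = proj₁ (proj₂ (inner-step (proj₁ (walk-edge (suc k) avoid)) (avoid (s≤s z≤n) ≤-refl)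
                                           (edge-sym undirected (proj₂ (walk-edge k (avoidsHub-≤ (n≤1+n k) avoid))))))

    InjectiveUpTo : ℕ → Set
    InjectiveUpTo j = ∀ {i i′} → i ≤ j → i′ ≤ j → x i ≡ x i′ → i ≡ i′

    -- An earlier occurrence of x (suc j) at an inner position would give that vertex a third neighbour.
    fresh : ∀ j → AvoidsHub (suc j) → InjectiveUpTo j → ∀ {i} → i ≤ j → ¬ x i ≡ x (suc j)
    fresh j avoid inj {i} i≤j with m≤n⇒m<n∨m≡n i≤j
    ... | inj₂ refl = edge⇒≢ {G = G} loopless (proj₂ (walk-edge j (avoidsHub-≤ (n≤1+n j) avoid)))
    fresh (suc j) avoid inj {i} _ | inj₁ (s≤s i≤j) with m≤n⇒m<n∨m≡n i≤j
    ... | inj₂ refl = no-backtrack i (avoidsHub-≤ (n≤1+n _) avoid) ∘ sym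
    fresh (suc j) avoid inj {zero}  _ | inj₁ _ | inj₁ _ = avoid (s≤s z≤n) ≤-refl ∘ sym
    fresh (suc j) avoid inj {suc i} _ | inj₁ _ | inj₁ i+2≤j = λ x≡ →
      [ (λ e → <⇒≢ i<j+1 (sym (inj ≤-refl i≤j+1 e)))
      , (λ e → <⇒≢ (s≤s i+2≤j) (sym (inj ≤-refl i+2≤j+1 e)))
      ] (inner-nbrs u≢w u≢p (edge-sym undirected (proj₂ (walk-edge i avoid-i))) (proj₂ (walk-edge (suc i) avoid-i+1))
                    (λ e → <⇒≢ (<-trans (n<1+n i) (n<1+n (suc i))) (sym (inj i+2≤j+1 i≤j+1 e)))
                    (subst (λ z → G z (x (suc j)) ≡ true) (sym x≡) (edge-sym undirected (proj₂ (walk-edge (suc j) (avoidsHub-≤ (n≤1+n _) avoid))))))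
      where
      i+2≤j+1 = ≤-trans i+2≤j (n≤1+n j)
      i<j+1 = <-trans (n<1+n i) i+2≤j+1
      i≤j+1 = <⇒≤ i<j+1
      avoid-i+1 = avoidsHub-≤ (≤-trans (<⇒≤ i+2≤j+1) (n≤1+n (suc j))) avoid
      avoid-i = avoidsHub-≤ (n≤1+n i) avoid-i+1
      u≢w = proj₁ (walk-edge (suc i) avoid-i+1)
      u≢p = avoid-i+1 (s≤s z≤n) ≤-refl

    injective-upTo : ∀ j → AvoidsHub j → InjectiveUpTo j
    injective-upTo zero    _     z≤n z≤n _ = refl
    injective-upTo (suc j) avoid {i} {i′} i≤ i′≤ e
      with IH ← injective-upTo j (avoidsHub-≤ (n≤1+n j) avoid)
      with m≤n⇒m<n∨m≡n i≤ | m≤n⇒m<n∨m≡n i′≤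
    ... | inj₁ (s≤s i≤j) | inj₁ (s≤s i′≤j) = IH i≤j i′≤j e
    ... | inj₂ refl      | inj₂ refl      = refl
    ... | inj₁ (s≤s i≤j) | inj₂ refl      = ⊥-elim (fresh j avoid IH i≤j e)
    ... | inj₂ refl      | inj₁ (s≤s i′≤j) = ⊥-elim (fresh j avoid IH i′≤j (sym e))

    -- Pigeonhole: a walk avoiding p for n steps would visit n + 1 distinct vertices.
    returns-to-hub : ∃ λ M → x (suc M) ≡ p × AvoidsHub M
    returns-to-hub with first-return n
      where
      first-return : ∀ j → AvoidsHub j ⊎ ∃ λ M → x (suc M) ≡ p × AvoidsHub M
      first-return zero = inj₁ λ 1≤i i≤0 → ⊥-elim (<⇒≱ 1≤i i≤0)
      first-return (suc j) with first-return j
      ... | inj₂ found = inj₂ found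
      ... | inj₁ avoid with x (suc j) ≟ p
      ...   | yes x≡p = inj₂ (j , x≡p , avoid)
      ...   | no  x≢p = inj₁ λ 1≤i i≤j+1 → [ (λ i<j+1 → avoid 1≤i (s≤s⁻¹ i<j+1)) , (λ { refl → x≢p }) ] (m≤n⇒m<n∨m≡n i≤j+1)
    ... | inj₂ found = found
    ... | inj₁ avoid = ⊥-elim (<⇒≱ (n<1+n n) (injective⇒≤ {f = x ∘ toℕ} λ e →
                         toℕ-injective (injective-upTo n avoid (s≤s⁻¹ (toℕ<n _)) (s≤s⁻¹ (toℕ<n _)) e)))

    module Around (b : Fin n) (pb : G p b ≡ true) (b≢w : ¬ b ≡ w) (b≢a : ¬ b ≡ a)
                  (M : ℕ) (x-return : x (suc M) ≡ p) (avoid-M : AvoidsHub M) where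

      hub-nbrs : ∀ {y} → G p y ≡ true → y ≡ w ⊎ y ≡ a ⊎ y ≡ b
      hub-nbrs = count≤3⇒⊎ {b = G p} (≤-reflexive deg-hub) (edge-sym undirected wp) pa pb a≢w b≢w b≢a

      inj-M : InjectiveUpTo M
      inj-M = injective-upTo M avoid-M

      edge-M : ∀ {i} → i ≤ M → G (x i) (x (suc i)) ≡ true
      edge-M i≤M = proj₂ (walk-edge _ (avoidsHub-≤ i≤M avoid-M))

      2≤M : 2 ≤ M
      2≤M = ≤∧≢⇒< (≤∧≢⇒< z≤n M≢0) M≢1
        where
        M≢0 : ¬ 0 ≡ M
        M≢0 0≡M = edge⇒≢ loopless pa (sym (subst (λ i → x (suc i) ≡ p) (sym 0≡M) x-return))
        M≢1 : ¬ 1 ≡ M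
        M≢1 1≡M = no-backtrack 0 (subst AvoidsHub (sym 1≡M) avoid-M) (subst (λ i → x (suc i) ≡ p) (sym 1≡M) x-return)

      x-M : x M ≡ b
      x-M with hub-nbrs (edge-sym undirected (subst (λ z → G (x M) z ≡ true) x-return (edge-M ≤-refl)))
      ... | inj₁ x≡w        = ⊥-elim (proj₁ (walk-edge M avoid-M) x≡w)
      ... | inj₂ (inj₁ x≡a) = ⊥-elim (<⇒≢ 2≤M (sym (inj-M ≤-refl (<⇒≤ 2≤M) x≡a)))
      ... | inj₂ (inj₂ x≡b) = x≡b

      hub-cycle-nbrs : ∀ {y} → G (x 0) y ≡ true → y ≡ w ⊎ y ≡ x 1 ⊎ y ≡ x M
      hub-cycle-nbrs e with hub-nbrs e
      ... | inj₁ y≡w        = inj₁ y≡w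
      ... | inj₂ (inj₁ y≡a) = inj₂ (inj₁ y≡a)
      ... | inj₂ (inj₂ y≡b) = inj₂ (inj₂ (trans y≡b (sym x-M)))

      inner-cycle-nbrs : ∀ {i y} → suc i ≤ M → G (x (suc i)) y ≡ true →
        y ≡ x i ⊎ (suc i < M × y ≡ x (suc (suc i))) ⊎ (suc i ≡ M × y ≡ x 0)
      inner-cycle-nbrs {i} i+1≤M e
        with inner-nbrs (proj₁ (walk-edge (suc i) avoid)) (avoid (s≤s z≤n) ≤-refl)
                        (edge-sym undirected (edge-M (≤-trans (n≤1+n i) i+1≤M))) (edge-M i+1≤M) distinct e
        where
        avoid = avoidsHub-≤ i+1≤M avoid-M
        distinct : ¬ x (suc (suc i)) ≡ x i
        distinct e with suc i ≟ℕ M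
        ... | no  i+1≢M = <⇒≢ (<-trans (n<1+n i) (n<1+n (suc i))) (sym (inj-M (≤∧≢⇒< i+1≤M i+1≢M) (≤-trans (n≤1+n i) i+1≤M) e))
        ... | yes refl  = <⇒≢ 2≤M (cong suc (sym (inj-M (≤-trans (n≤1+n _) i+1≤M) z≤n (trans (sym e) x-return))))
      ... | inj₁ y≡xi = inj₁ y≡xi
      ... | inj₂ y≡xi+2 with suc i ≟ℕ M
      ...   | no  i+1≢M = inj₂ (inj₁ (≤∧≢⇒< i+1≤M i+1≢M , y≡xi+2))
      ...   | yes refl  = inj₂ (inj₂ (refl , trans y≡xi+2 x-return))

      OnCycle : Fin n → Set
      OnCycle y = y ≡ w ⊎ ∃ λ i → i ≤ M × x i ≡ y

      onCycle-closed : ∀ {y z} → OnCycle y → G y z ≡ true → OnCycle z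
      onCycle-closed (inj₁ refl) e = inj₂ (0 , z≤n , sym (only-w e))
      onCycle-closed (inj₂ (zero , _ , refl)) e with hub-cycle-nbrs e
      ... | inj₁ z≡w        = inj₁ z≡w
      ... | inj₂ (inj₁ z≡x) = inj₂ (1 , ≤-trans (n≤1+n 1) 2≤M , sym z≡x)
      ... | inj₂ (inj₂ z≡x) = inj₂ (M , ≤-refl , sym z≡x)
      onCycle-closed (inj₂ (suc i , i+1≤M , refl)) e with inner-cycle-nbrs i+1≤M e
      ... | inj₁ z≡x                  = inj₂ (i , ≤-trans (n≤1+n i) i+1≤M , sym z≡x)
      ... | inj₂ (inj₁ (i+1<M , z≡x)) = inj₂ (suc (suc i) , i+1<M , sym z≡x)
      ... | inj₂ (inj₂ (_ , z≡x))     = inj₂ (0 , z≤n , sym z≡x)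

      vertexAt : ℕ → Fin n
      vertexAt I with I ≤? M
      ... | yes _ = x I
      ... | no _  = w

      vertexAt-≤ : ∀ {I} → I ≤ M → vertexAt I ≡ x I
      vertexAt-≤ {I} I≤M with I ≤? M
      ... | yes _  = refl
      ... | no I≰M = ⊥-elim (I≰M I≤M)

      vertexAt-top : vertexAt (suc M) ≡ w
      vertexAt-top with suc M ≤? M
      ... | yes M+1≤M = ⊥-elim (<-irrefl refl M+1≤M)
      ... | no _      = refl

      x≢w : ∀ {i} → i ≤ M → ¬ x i ≡ w
      x≢w i≤M = proj₁ (walk-edge _ (avoidsHub-≤ i≤M avoid-M))

      vertexAt-injective : ∀ {I J} → I ≤ suc M → J ≤ suc M → vertexAt I ≡ vertexAt J → I ≡ J
      vertexAt-injective {I} {J} I≤ J≤ e with I ≤? M | J ≤? M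
      ... | yes I≤M | yes J≤M = inj-M I≤M J≤M e
      ... | yes I≤M | no _    = ⊥-elim (x≢w I≤M e)
      ... | no _    | yes J≤M = ⊥-elim (x≢w J≤M (sym e))
      ... | no I≰M  | no J≰M  = trans (≤-antisym I≤ (≰⇒> I≰M)) (sym (≤-antisym J≤ (≰⇒> J≰M)))

      Adj⇒G : ∀ {I J} → Adj (suc (suc M)) I J → G (vertexAt I) (vertexAt J) ≡ true
      Adj⇒G (inj₁ cyc)                    = cycle-edge cyc
        where
        cycle-edge : ∀ {I J} → Cyc (suc (suc M)) I J → G (vertexAt I) (vertexAt J) ≡ true
        cycle-edge (s≤s I≤M , s≤s J≤M , inj₁ refl) =
          subst₂ (λ y z → G y z ≡ true) (sym (vertexAt-≤ I≤M)) (sym (vertexAt-≤ J≤M)) (edge-M I≤M)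
        cycle-edge (_ , _ , inj₂ (refl , refl)) =
          subst₂ (λ y z → G y z ≡ true) (sym (vertexAt-≤ z≤n)) (sym (vertexAt-≤ ≤-refl))
                 (edge-sym undirected (subst (λ z → G (x M) z ≡ true) x-return (edge-M ≤-refl)))
      Adj⇒G (inj₂ (inj₁ cyc))             = edge-sym undirected (Adj⇒G (inj₁ cyc))
      Adj⇒G (inj₂ (inj₂ (inj₁ (refl , refl)))) = subst₂ (λ y z → G y z ≡ true) (sym vertexAt-top) (sym (vertexAt-≤ z≤n)) wp
      Adj⇒G (inj₂ (inj₂ (inj₂ (refl , refl)))) = edge-sym undirected (Adj⇒G (inj₂ (inj₂ (inj₁ (refl , refl)))))

      vertexAt-cases : ∀ {I} → I ≤ suc M → (I ≤ M × vertexAt I ≡ x I) ⊎ (I ≡ suc M × vertexAt I ≡ w)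
      vertexAt-cases {I} I≤ with I ≤? M
      ... | yes I≤M = inj₁ (I≤M , refl)
      ... | no I≰M  = inj₂ (≤-antisym I≤ (≰⇒> I≰M) , refl)

      cycle-adj : ∀ {I J} → I ≤ M → J ≤ M → G (x I) (x J) ≡ true → Adj (suc (suc M)) I J
      cycle-adj {zero} _ J≤M e with hub-cycle-nbrs e
      ... | inj₁ xJ≡w = ⊥-elim (x≢w J≤M xJ≡w)
      ... | inj₂ (inj₁ xJ≡x₁) with refl ← inj-M J≤M (≤-trans (n≤1+n 1) 2≤M) xJ≡x₁ =
        inj₁ (s≤s z≤n , s≤s (≤-trans (n≤1+n 1) 2≤M) , inj₁ refl)
      ... | inj₂ (inj₂ xJ≡xM) with refl ← inj-M J≤M ≤-refl xJ≡xM = inj₁ (s≤s z≤n , ≤-refl , inj₂ (refl , refl))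
      cycle-adj {suc i} i+1≤M J≤M e with inner-cycle-nbrs i+1≤M e
      ... | inj₁ xJ≡xi with refl ← inj-M J≤M (≤-trans (n≤1+n i) i+1≤M) xJ≡xi =
        inj₂ (inj₁ (s≤s (≤-trans (n≤1+n i) i+1≤M) , s≤s i+1≤M , inj₁ refl))
      ... | inj₂ (inj₁ (i+1<M , xJ≡xi+2)) with refl ← inj-M J≤M i+1<M xJ≡xi+2 = inj₁ (s≤s i+1≤M , s≤s i+1<M , inj₁ refl)
      ... | inj₂ (inj₂ (i+1≡M , xJ≡x₀)) with refl ← inj-M J≤M z≤n xJ≡x₀ =
        inj₂ (inj₁ (s≤s z≤n , s≤s i+1≤M , inj₂ (refl , i+1≡M)))

      G⇒Adj : ∀ {I J} → I ≤ suc M → J ≤ suc M → G (vertexAt I) (vertexAt J) ≡ true → Adj (suc (suc M)) I J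
      G⇒Adj {I} {J} I≤ J≤ e with vertexAt-cases I≤ | vertexAt-cases J≤
      ... | inj₂ (refl , vI≡w) | _ = inj₂ (inj₂ (inj₁ (refl , vertexAt-injective J≤ z≤n
              (trans (only-w (subst (λ y → G y (vertexAt J) ≡ true) vI≡w e)) (sym (vertexAt-≤ z≤n))))))
      ... | inj₁ _ | inj₂ (refl , vJ≡w) = inj₂ (inj₂ (inj₂ (refl , vertexAt-injective I≤ z≤n
              (trans (only-w (edge-sym undirected (subst (λ y → G (vertexAt I) y ≡ true) vJ≡w e))) (sym (vertexAt-≤ z≤n))))))
      ... | inj₁ (I≤M , vI≡x) | inj₁ (J≤M , vJ≡x) = cycle-adj I≤M J≤M (subst₂ (λ y z → G y z ≡ true) vI≡x vJ≡x e)

      module _ (connected : Connected G) where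

        onCycle : ∀ y → OnCycle y
        onCycle y = Reach-closed OnCycle onCycle-closed (inj₂ (0 , z≤n , refl)) (connected p y)

        position : Fin n → ℕ
        position y with onCycle y
        ... | inj₁ _           = suc M
        ... | inj₂ (i , _ , _) = i

        position≤ : ∀ y → position y ≤ suc M
        position≤ y with onCycle y
        ... | inj₁ _             = ≤-refl
        ... | inj₂ (_ , i≤M , _) = m≤n⇒m≤1+n i≤M

        vertexAt-position : ∀ y → vertexAt (position y) ≡ y
        vertexAt-position y with onCycle y
        ... | inj₁ refl             = vertexAt-top
        ... | inj₂ (_ , i≤M , refl) = vertexAt-≤ i≤M

        position-injective : ∀ {y z} → position y ≡ position z → y ≡ z
        position-injective {y} {z} e = trans (sym (vertexAt-position y)) (trans (cong vertexAt e) (vertexAt-position z))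

        n≡M+2 : n ≡ suc (suc M)
        n≡M+2 = ≤-antisym
          (injective⇒≤ {f = λ y → fromℕ< (s≤s (position≤ y))} λ e →
             position-injective (trans (sym (toℕ-fromℕ< _)) (trans (cong toℕ e) (toℕ-fromℕ< _))))
          (injective⇒≤ {f = vertexAt ∘ toℕ} λ e →
             toℕ-injective (vertexAt-injective (s≤s⁻¹ (toℕ<n _)) (s≤s⁻¹ (toℕ<n _)) e))

        relabel : Fin n → Fin n
        relabel y = fromℕ< (subst (position y <_) (sym n≡M+2) (s≤s (position≤ y)))

        toℕ-relabel : ∀ y → toℕ (relabel y) ≡ position y
        toℕ-relabel y = toℕ-fromℕ< _

        relabel-bijection : Fin n ⤖ Fin n
        relabel-bijection = mk⤖ {to = relabel} (injective , surjective)
          where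
          injective : ∀ {y z} → relabel y ≡ relabel z → y ≡ z
          injective {y} {z} e = position-injective (trans (sym (toℕ-relabel y)) (trans (cong toℕ e) (toℕ-relabel z)))
          surjective : ∀ t → ∃ λ y → ∀ {z} → z ≡ y → relabel z ≡ t
          surjective t = vertexAt (toℕ t) , λ { refl → toℕ-injective (trans (toℕ-relabel _)
            (vertexAt-injective (position≤ _) t≤ (vertexAt-position (vertexAt (toℕ t))))) }
            where t≤ = s≤s⁻¹ (subst (toℕ t <_) n≡M+2 (toℕ<n t))

        G⇔Adj : ∀ u v → G u v ≡ true ⇔ Adj (suc (suc M)) (position u) (position v)
        G⇔Adj u v = subst₂ (λ y z → G y z ≡ true ⇔ Adj (suc (suc M)) (position u) (position v))
                           (vertexAt-position u) (vertexAt-position v) (mk⇔ (G⇒Adj (position≤ u) (position≤ v)) Adj⇒G)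

        Adj⇔Adj-relabel : ∀ u v → Adj (suc (suc M)) (position u) (position v) ⇔ Adj n (toℕ (relabel u)) (toℕ (relabel v))
        Adj⇔Adj-relabel u v = mk⇔ (subst id same) (subst id (sym same))
          where
          same = trans (cong (λ m → Adj m (position u) (position v)) (sym n≡M+2))
                       (cong₂ (Adj n) (sym (toℕ-relabel u)) (sym (toℕ-relabel v)))

        ≅P1 : G ≅ P1 n
        ≅P1 = relabel-bijection , λ u v →
          Bool.⇔→≡ {z = true} ((⇔-sym (P1⇔Adj n (relabel u) (relabel v)) ⇔-∘ Adj⇔Adj-relabel u v) ⇔-∘ G⇔Adj u v)

-- a, b and M are bound by pattern matching so that they stay opaque: unfolded into the searches
-- producing them, they make checking the cycle lemmas prohibitively expensive.
P1Degrees⇒≅P1 : ∀ {n} {G : Graph n} → Undirected G → Loopless G → Connected G → P1Degrees G → G ≅ P1 n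
P1Degrees⇒≅P1 {G = G} undirected loopless connected P
  with a , pa , a≢w ← Walk.hub-other G undirected loopless P
  with b , pb , b≢w , b≢a ← Walk.hub-third G undirected loopless P pa a≢w
  with M , x-return , avoid-M ← Walk.FromHub.returns-to-hub G undirected loopless P a pa a≢w
  = Walk.FromHub.Around.≅P1 G undirected loopless P a pa a≢w b pb b≢w b≢a M x-return avoid-M connected

approx≡⇒≡√ : ∀ {xs ys : List ℕ} → (∀ k → approx k xs ≡ approx k ys) → xs ≡√ ys
approx≡⇒≡√ {xs} {ys} e = (λ k → ≤-trans (≤-reflexive (e k)) (m≤m+n _ _)) , (λ k → ≤-trans (≤-reflexive (sym (e k))) (m≤m+n _ _))

theorem4p2 : (n : ℕ) → 4 ≤ n → (G : Graph n) → IsSimple G → Connected G →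
    ExactlyOneBridge G →
    (somborBound n ≤√ somborTerms G) × ((somborTerms G ≡√ somborBound n) ⇔ (G ≅ P1 n))
theorem4p2 n 4≤n@(s≤s (s≤s (s≤s (s≤s _)))) G (undirected , loopless) connected one-bridge =
  somborBound≤√somborTerms , mk⇔ equality⇒P1 P1⇒equality
  where
  3≤n = ≤-trans (n≤1+n 3) 4≤n
  open SomborBound G undirected loopless connected one-bridge 3≤n
  equality⇒P1 : somborTerms G ≡√ somborBound n → G ≅ P1 n
  equality⇒P1 (terms≤bound , _) = P1Degrees⇒≅P1 undirected loopless connected (≤√⇒P1Degrees terms≤bound)
  P1⇒equality : G ≅ P1 n → somborTerms G ≡√ somborBound n
  P1⇒equality iso = approx≡⇒≡√ {somborTerms G} {somborBound n} (P1Degrees⇒approx≡ undirected loopless (P1Degrees-≅ iso P1-degrees) 3≤n)
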